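{- Let $P=\mathcal{Z}_4$ and $x\in P$. Let $\mathcal{O}$ be a promotion orbit of $\mathrm{Inc}^q(P)$. Then $\mathcal{O}$ exhibits orbitmesy with respect to the antipodal sum statistic $\mathcal{A}_x$ if and only if $\mathcal{O}$ avoids $1324$ or is balanced.
   Context: $\mathcal{Z}_4$ is the zig-zag (fence) poset $x_1\lessdot x_2 \gtrdot x_3\lessdot x_4$; it is self-dual with order-reversing involution $\kappa$ exchanging $x_1\leftrightarrow x_4$ and $x_2\leftrightarrow x_3$. An increasing labeling of a finite poset $P$ is $f:P\to\mathbb{N}$ with $f(x)<f(y)$ whenever $x<y$; $\mathrm{Inc}^q(P)$ is the set of increasing labelings with values in $[q]=\{1,\dots,q\}$. Promotion $\mathrm{Pro}$ on $\mathrm{Inc}^q(P)$: replace every label $1$ by an empty box; for $i=2,\dots,q$ in turn, perform the jeu de taquin slide $\sigma_i$ (a box at $x$ becomes $i$ if some $y\gtrdot x$ is labeled $i$, and an element labeled $i$ that covers a box becomes a box); then replace all boxes by $q+1$ and subtract $1$ from every label. The antipodal sum statistic is $\mathcal{A}_x(f)=f(x)+f(\kappa(x))$. An orbit $\mathcal{O}$ is orbitmesic with respect to a statistic $\eta$ if the average of $\eta$ over $\mathcal{O}$ equals the average of $\eta$ over all of $\mathrm{Inc}^q(P)$. A labeling of $\mathcal{Z}_4$ contains the pattern $\pi$ if the word of labels read left to right ($f(x_1)f(x_2)f(x_3)f(x_4)$) has a subsequence in the same relative order as $\pi$; it avoids $\pi$ otherwise, and an orbit avoids $\pi$ if all its labelings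 do. A labeling in $\mathrm{Inc}^q(\mathcal{Z}_4)$ whose labels in weakly increasing order are $w\le x\le y\le z$ is balanced if $x-w=z-y$ or $w-z+q=y-x$, and imbalanced otherwise; an orbit is balanced if its elements are (balancedness is constant on promotion orbits). -}

module Defs where

open import Data.Nat using (ℕ; zero; suc; _+_; _*_; _∸_; _≤_; _<_; _≤ᵇ_; _≡ᵇ_)
open import Data.Nat.Properties using (_≟_)
open import Data.Bool using (Bool; true; false; if_then_else_; _∧_; _∨_; not)
open import Data.Maybe using (Maybe; just; nothing; maybe)
open import Data.Fin using (Fin; zero; suc)
open import Data.List using (List; []; _∷_; map; upTo; length; foldl; filterᵇ; concatMap)
open import Data.Bool.ListAction using (any)
open import Data.Nat.ListAction using (sum)
open import Data.List.Relation.Binary.Sublist.Propositional using (_⊆_)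
open import Data.List.Relation.Binary.Pointwise using (Pointwise)
open import Data.Vec using (Vec; []; _∷_; lookup; tabulate; toList)
import Data.Vec.Properties as VecP
open import Data.Product using (_×_; Σ)
open import Data.Sum using (_⊎_)
import Data.Integer as ℤ
open ℤ using (ℤ) renaming (+_ to ⁺_)
open import Function.Bundles using (_⇔_)
open import Relation.Binary.PropositionalEquality using (_≡_)
open import Relation.Nullary using (¬_; does)
open import Data.List.Relation.Unary.All using (All)
open import Data.Empty using (⊥)

-- The zig-zag poset Z4 on Fin 4: index 0,1,2,3 stand for x1,x2,x3,x4.
-- Relations: x1 ⋖ x2, x3 ⋖ x2, x3 ⋖ x4 (these are all strict relations).

Z4 : Set
Z4 = Fin 4

pattern x₁ = zero
pattern x₂ = suc zero
pattern x₃ = suc (suc zero)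
pattern x₄ = suc (suc (suc zero))

upCovers : Z4 → List Z4
upCovers x₁ = x₂ ∷ []
upCovers x₂ = []
upCovers x₃ = x₂ ∷ x₄ ∷ []
upCovers x₄ = []

downCovers : Z4 → List Z4
downCovers x₁ = []
downCovers x₂ = x₁ ∷ x₃ ∷ []
downCovers x₃ = []
downCovers x₄ = x₃ ∷ []

κ : Z4 → Z4
κ x₁ = x₄
κ x₂ = x₃
κ x₃ = x₂
κ x₄ = x₁

Labeling : Set
Labeling = Vec ℕ 4

isIncreasingᵇ : Labeling → Bool
isIncreasingᵇ (a ∷ b ∷ c ∷ d ∷ []) =
  (suc a ≤ᵇ b) ∧ (suc c ≤ᵇ b) ∧ (suc c ≤ᵇ d)

range : ℕ → List ℕ
range q = map suc (upTo q)

allLabelings : ℕ → List Labeling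
allLabelings q =
  concatMap (λ a → concatMap (λ b → concatMap (λ c → map (λ d →
    a ∷ b ∷ c ∷ d ∷ []) (range q)) (range q)) (range q)) (range q)

Inc : ℕ → List Labeling
Inc q = filterᵇ isIncreasingᵇ (allLabelings q)

-- Promotion (jeu de taquin), boxes are represented by nothing

State : Set
State = Vec (Maybe ℕ) 4

isLabel : ℕ → Maybe ℕ → Bool
isLabel i (just v) = v ≡ᵇ i
isLabel i nothing  = false

isBox : Maybe ℕ → Bool
isBox nothing  = true
isBox (just _) = false

-- the slide σ_i, performed simultaneously on all elements
slide : ℕ → State → State
slide i s = tabulate step
  where
  step : Z4 → Maybe ℕ
  step x with lookup s x
  ... | nothing =
        if any (λ y → isLabel i (lookup s y)) (upCovers x) then just i else nothing
  ... | just v =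
        if (v ≡ᵇ i) ∧ any (λ y → isBox (lookup s y)) (downCovers x)
        then nothing else just v

Pro : ℕ → Labeling → Labeling
Pro q f = Data.Vec.map finish (foldl (λ s i → slide i s) start (map (2 +_) (upTo (q ∸ 1))))
  where
  start : State
  start = Data.Vec.map (λ v → if v ≡ᵇ 1 then nothing else just v) f
  -- boxes become q+1, then every label is decreased by 1
  finish : Maybe ℕ → ℕ
  finish = maybe (λ v → v ∸ 1) q

iterate : ℕ → (Labeling → Labeling) → Labeling → Labeling
iterate zero    g f = f
iterate (suc k) g f = g (iterate k g f)

-- g lies in the promotion orbit of f: g = Pro^k f for some k.  Since
-- Inc^q(Z4) is finite with |Inc q| elements, it suffices to look at
-- k ≤ |Inc q|.
inOrbitᵇ : ℕ → Labeling → Labeling → Bool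
inOrbitᵇ q f g =
  any (λ k → does (VecP.≡-dec _≟_ (iterate k (Pro q) f) g)) (upTo (suc (length (Inc q))))

orbit : ℕ → Labeling → List Labeling
orbit q f = filterᵇ (inOrbitᵇ q f) (Inc q)

antipodalSum : Z4 → Labeling → ℕ
antipodalSum x f = lookup f x + lookup f (κ x)

-- O is orbitmesic for η (in Inc^q): avg_O η = avg_{Inc^q} η,
-- written with cross-multiplied denominators
Orbitmesic : ℕ → (Labeling → ℕ) → List Labeling → Set
Orbitmesic q η O =
  sum (map η O) * length (Inc q) ≡ sum (map η (Inc q)) * length O

data SameOrder : List ℕ → List ℕ → Set where
  []  : SameOrder [] []
  _∷_ : ∀ {a b s p} →
        Pointwise (λ a' b' → ((a < a') ⇔ (b < b')) × ((a' < a) ⇔ (b' < b))) s p →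
        SameOrder s p → SameOrder (a ∷ s) (b ∷ p)

Contains : List ℕ → List ℕ → Set
Contains π w = Σ (List ℕ) λ s → (s ⊆ w) × SameOrder s π

word : Labeling → List ℕ
word = toList

Avoids : List ℕ → Labeling → Set
Avoids π f = ¬ Contains π (word f)

OrbitAvoids : List ℕ → List Labeling → Set
OrbitAvoids π O = All (Avoids π) O

insert : ℕ → List ℕ → List ℕ
insert a [] = a ∷ []
insert a (b ∷ bs) = if a ≤ᵇ b then a ∷ b ∷ bs else b ∷ insert a bs

isort : List ℕ → List ℕ
isort [] = []
isort (a ∷ as) = insert a (isort as)

BalancedSorted : ℕ → List ℕ → Set
BalancedSorted q (w ∷ x ∷ y ∷ z ∷ []) =
  ((⁺ x) ℤ.- (⁺ w) ≡ (⁺ z) ℤ.- (⁺ y)) ⊎ ((⁺ w) ℤ.- (⁺ z) ℤ.+ (⁺ q) ≡ (⁺ y) ℤ.- (⁺ x))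
BalancedSorted q _ = ⊥

Balanced : ℕ → Labeling → Set
Balanced q f = BalancedSorted q (isort (word f))

OrbitBalanced : ℕ → List Labeling → Set
OrbitBalanced q O = All (Balanced q) O

{-# OPTIONS --safe #-}
module Submission where

-- Promotion lowers every label by one unless some label is 1; then the elements labelled 1 are
-- pushed up and the element at the end of the slide gets the value q. Describing a labeling with
-- minimum 1 by its shape (the standardised word f(x₁)f(x₂)f(x₃)f(x₄)) and its cyclic gap vector,
-- such a jump moves to the next shape and rotates the gaps, so an orbit runs through a cycle of
-- shapes together with the rotations of one gap vector. There are four cycles: {1324, 2413},
-- {1423, 3412, 2314}, {1213, 1312, 2313, 1323, 2312} and {1212}. Over a period, the sum of the
-- antipodal statistic is a polynomial in the gaps: for the last three cycles, whose labelings
-- avoid 1324, it is q + 1 times the period; for the first it is off by ±(h₁ − h₃)(h₂ − h₄),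
-- which vanishes exactly when the orbit is balanced. Finally f ↦ q + 1 − f ∘ κ is an involution
-- of Inc^q(Z₄) pairing antipodal sums to 2(q + 1), so q + 1 is also the global mean.

open import Defs
open import Data.Nat
open import Data.Nat.Properties
open import Data.Nat.DivMod using (_%_; _/_; m≡m%n+[m/n]*n; m%n<n)
open import Data.Nat.Induction using (<-rec)
open import Data.Nat.ListAction using (sum)
open import Data.Nat.ListAction.Properties using (sum-++; sum-↭)
open import Data.Nat.Tactic.RingSolver using (solve-∀)
open import Algebra.Properties.CommutativeSemigroup +-commutativeSemigroup using (interchange; x∙yz≈y∙xz)
import Data.Integer as ℤ
import Data.Integer.Properties as ℤP
import Data.Integer.Tactic.RingSolver as ℤSolver
open ℤ using (ℤ) renaming (+_ to ⁺_)
open import Data.Bool using (true; false; T; _∧_; if_then_else_)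
open import Data.Bool.Properties using (∧-zeroʳ; T-∧; T-≡)
open import Data.Bool.ListAction using (any)
open import Data.Empty using (⊥)
open import Data.Unit using (⊤)
open import Data.Maybe using (just; nothing; maybe)
open import Data.Fin as Fin using (Fin; #_; toℕ)
open import Data.Fin.Properties using (pigeonhole; toℕ<n)
open import Data.List as List using (List; []; _∷_; _++_; map; length; foldl; upTo; applyUpTo; concatMap; filterᵇ)
open import Data.List.Properties using (map-++; map-∘; map-cong; map-upTo)
open import Data.List.Membership.Propositional using (_∈_; find; lose)
open import Data.List.Membership.Propositional.Properties
  using (∈-map⁺; ∈-map⁻; ∈-concatMap⁺; ∈-concatMap⁻; ∈-filter⁺; ∈-filter⁻; ∈-upTo⁺; ∈-upTo⁻)
open import Data.List.Membership.Propositional.Properties.WithK using (unique∧set⇒bag)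
open import Data.List.Relation.Binary.BagAndSetEquality using (∼bag⇒↭)
open import Data.List.Relation.Binary.Permutation.Propositional using (_↭_; ↭-sym; ↭-trans; module PermutationReasoning)
open import Data.List.Relation.Binary.Permutation.Propositional.Properties
  using (++-comm; ↭-length; map⁺; ∈-resp-↭; All-resp-↭)
open import Data.List.Relation.Binary.Pointwise using ([]; _∷_)
open import Data.List.Relation.Binary.Sublist.Heterogeneous using ([]; _∷_)
open import Data.List.Relation.Binary.Sublist.Heterogeneous.Properties using (toPointwise)
open import Data.List.Relation.Unary.All as All using (All; []; _∷_)
import Data.List.Relation.Unary.All.Properties as All
open import Data.List.Relation.Unary.AllPairs using ([]; _∷_)
open import Data.List.Relation.Unary.Any using (here; there; index)
open import Data.List.Relation.Unary.Any.Properties using (any⁺; any⁻; lookup-index)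
open import Data.List.Relation.Unary.Unique.Propositional using (Unique)
import Data.List.Relation.Unary.Unique.Propositional.Properties as Unique
open import Data.Vec as Vec using (Vec; []; _∷_; _∷ʳ_; lookup; head; tabulate)
open import Data.Vec.Properties using (map-id; lookup-map)
import Data.Vec.Properties as Vec
open import Data.Vec.Relation.Unary.All as VecAll using ([]; _∷_)
import Data.Vec.Relation.Unary.All.Properties as VecAll
open import Data.Product using (∃; _×_; _,_; proj₁; proj₂)
open import Data.Sum using (_⊎_; inj₁; inj₂)
open import Function using (_∘_)
open import Function.Bundles using (_⇔_; mk⇔; Equivalence)
open import Function.Properties.Equivalence using (⇔-setoid) renaming (trans to ⇔-trans; sym to ⇔-sym)
open import Level using (0ℓ)
open import Relation.Binary.Definitions using (DecidableEquality; tri<; tri≈; tri>)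
open import Relation.Binary.PropositionalEquality
import Relation.Binary.Reasoning.Setoid as SetoidReasoning
open import Relation.Nullary using (¬_; Dec; yes; no; does; contradiction)
open import Relation.Nullary.Decidable using (T?; _×-dec_)

module ⇔-Reasoning = SetoidReasoning (⇔-setoid 0ℓ)

-- Iterating a map, and orbits inside a finite invariant list

module _ (g : Labeling → Labeling) where

  iterate-suc : ∀ n x → iterate n g (g x) ≡ g (iterate n g x)
  iterate-suc zero    x = refl
  iterate-suc (suc n) x = cong g (iterate-suc n x)

  iterate-+ : ∀ m n x → iterate (m + n) g x ≡ iterate m g (iterate n g x)
  iterate-+ zero    n x = refl
  iterate-+ (suc m) n x = cong g (iterate-+ m n x)

  iterate-periodic : ∀ {p x} → iterate p g x ≡ x → ∀ k → iterate p g (iterate k g x) ≡ iterate k g x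
  iterate-periodic {p} {x} per k = begin
    iterate p g (iterate k g x) ≡⟨ iterate-+ p k x ⟨
    iterate (p + k) g x         ≡⟨ cong (λ n → iterate n g x) (+-comm p k) ⟩
    iterate (k + p) g x         ≡⟨ iterate-+ k p x ⟩
    iterate k g (iterate p g x) ≡⟨ cong (iterate k g) per ⟩
    iterate k g x               ∎
    where open ≡-Reasoning

  iterate-*-periodic : ∀ {d x} → iterate d g x ≡ x → ∀ m → iterate (m * d) g x ≡ x
  iterate-*-periodic per zero    = refl
  iterate-*-periodic {d} {x} per (suc m) =
    trans (iterate-+ d (m * d) x) (trans (cong (iterate d g) (iterate-*-periodic per m)) per)

  iterates : ℕ → Labeling → List Labeling
  iterates zero    x = []
  iterates (suc n) x = x ∷ iterates n (g x)

  iterates-+ : ∀ m n x → iterates (m + n) x ≡ iterates m x ++ iterates n (iterate m g x)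
  iterates-+ zero    n x = refl
  iterates-+ (suc m) n x =
    cong (x ∷_) (trans (iterates-+ m n (g x)) (cong (λ y → iterates m (g x) ++ iterates n y) (iterate-suc m x)))

  length-iterates : ∀ n x → length (iterates n x) ≡ n
  length-iterates zero    x = refl
  length-iterates (suc n) x = cong suc (length-iterates n (g x))

  ∈-iterates⁺ : ∀ {k n} x → k < n → iterate k g x ∈ iterates n x
  ∈-iterates⁺ {zero}  {suc n} x k<n = here refl
  ∈-iterates⁺ {suc k} {suc n} x (s≤s k<n) = there (subst (_∈ iterates n (g x)) (iterate-suc k x) (∈-iterates⁺ (g x) k<n))

  ∈-iterates⁻ : ∀ {y} n x → y ∈ iterates n x → ∃ λ k → k < n × iterate k g x ≡ y
  ∈-iterates⁻ (suc n) x (here refl) = 0 , s≤s z≤n , refl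
  ∈-iterates⁻ (suc n) x (there y∈) with ∈-iterates⁻ n (g x) y∈
  ... | k , k<n , refl = suc k , s≤s k<n , sym (iterate-suc k x)

  iterates-rotate : ∀ {p x} → iterate p g x ≡ x → iterates p (g x) ↭ iterates p x
  iterates-rotate {zero}      per = _↭_.refl
  iterates-rotate {suc n} {x} per = begin
    iterates (suc n) (g x)                             ≡⟨ cong (λ m → iterates m (g x)) (+-comm 1 n) ⟩
    iterates (n + 1) (g x)                             ≡⟨ iterates-+ n 1 (g x) ⟩
    iterates n (g x) ++ iterate n g (g x) ∷ []
      ≡⟨ cong (λ y → iterates n (g x) ++ y ∷ []) (trans (iterate-suc n x) per) ⟩
    iterates n (g x) ++ x ∷ []                         ↭⟨ ++-comm (iterates n (g x)) (x ∷ []) ⟩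
    x ∷ iterates n (g x)                               ∎
    where open PermutationReasoning

  iterates-shift : ∀ {p x} → iterate p g x ≡ x → ∀ k → iterates p (iterate k g x) ↭ iterates p x
  iterates-shift per zero    = _↭_.refl
  iterates-shift {p} {x} per (suc k) =
    ↭-trans (iterates-rotate {p} (iterate-periodic {p} per k)) (iterates-shift per k)

  sum-iterates-* : ∀ (η : Labeling → ℕ) {d x} → iterate d g x ≡ x →
                   ∀ m → sum (map η (iterates (m * d) x)) ≡ m * sum (map η (iterates d x))
  sum-iterates-* η per zero = refl
  sum-iterates-* η {d} {x} per (suc m) = begin
    sum (map η (iterates (d + m * d) x))
      ≡⟨ cong (sum ∘ map η) (iterates-+ d (m * d) x) ⟩
    sum (map η (iterates d x ++ iterates (m * d) (iterate d g x)))
      ≡⟨ cong (λ y → sum (map η (iterates d x ++ iterates (m * d) y))) per ⟩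
    sum (map η (iterates d x ++ iterates (m * d) x))           ≡⟨ cong sum (map-++ η (iterates d x) _) ⟩
    sum (map η (iterates d x) ++ map η (iterates (m * d) x))   ≡⟨ sum-++ (map η (iterates d x)) _ ⟩
    sum (map η (iterates d x)) + sum (map η (iterates (m * d) x))
      ≡⟨ cong (sum (map η (iterates d x)) +_) (sum-iterates-* η per m) ⟩
    sum (map η (iterates d x)) + m * sum (map η (iterates d x)) ∎
    where open ≡-Reasoning

T-does : ∀ {P : Set} (P? : Dec P) → P → T (does P?)
T-does (yes _) _ = _
T-does (no ¬p) p = ¬p p

does-T : ∀ {P : Set} (P? : Dec P) → T (does P?) → P
does-T (yes p) _ = p

module _ (_≟_ : DecidableEquality Labeling) (g : Labeling → Labeling) where

  record MinimalPeriod (x : Labeling) : Set where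
    field
      period   : ℕ
      0<period : 0 < period
      periodic : iterate period g x ≡ x
      minimal  : ∀ {k} → 0 < k → k < period → iterate k g x ≢ x

  minimalPeriod : ∀ p {x} → 0 < p → iterate p g x ≡ x → MinimalPeriod x
  minimalPeriod p {x} = <-rec (λ p → 0 < p → iterate p g x ≡ x → MinimalPeriod x) shorten p
    where
    shorten : ∀ p → (∀ {k} → k < p → 0 < k → iterate k g x ≡ x → MinimalPeriod x) →
              0 < p → iterate p g x ≡ x → MinimalPeriod x
    shorten p rec 0<p per with anyUpTo? (λ k → 0 <? k ×-dec iterate k g x ≟ x) p
    ... | yes (k , k<p , 0<k , per-k) = rec k<p 0<k per-k
    ... | no none = record { period = p ; 0<period = 0<p ; periodic = per
                           ; minimal = λ 0<k k<p per-k → none (_ , k<p , 0<k , per-k) }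

  module _ {x : Labeling} (mp : MinimalPeriod x) where
    open MinimalPeriod mp

    private instance
      period≢0 : NonZero period
      period≢0 = >-nonZero 0<period

    iterate-mod-period : ∀ k → iterate k g x ≡ iterate (k % period) g x
    iterate-mod-period k = begin
      iterate k g x
        ≡⟨ cong (λ n → iterate n g x) (m≡m%n+[m/n]*n k period) ⟩
      iterate (k % period + (k / period) * period) g x ≡⟨ iterate-+ g (k % period) _ x ⟩
      iterate (k % period) g (iterate ((k / period) * period) g x)
                                                       ≡⟨ cong (iterate (k % period) g) (iterate-*-periodic g periodic (k / period)) ⟩
      iterate (k % period) g x                         ∎
      where open ≡-Reasoning

    period-divides : ∀ {p} → iterate p g x ≡ x → p ≡ (p / period) * period
    period-divides {p} per with p % period in eq
    ... | zero  = trans (m≡m%n+[m/n]*n p period) (cong (_+ (p / period) * period) eq)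
    ... | suc r = contradiction (trans (cong (λ n → iterate n g x) (sym eq)) (trans (sym (iterate-mod-period p)) per))
                                (minimal (s≤s z≤n) (subst (_< period) eq (m%n<n p period)))

    period-≤ : ∀ {p} → 0 < p → iterate p g x ≡ x → period ≤ p
    period-≤ 0<p per = ≮⇒≥ (λ p<period → minimal 0<p p<period per)

    ∈-iterates-period : ∀ k → iterate k g x ∈ iterates g period x
    ∈-iterates-period k = subst (_∈ iterates g period x) (sym (iterate-mod-period k)) (∈-iterates⁺ g x (m%n<n k period))

    iterates-period-distinct : ∀ {i j} → i < j → j < period → iterate i g x ≢ iterate j g x
    iterates-period-distinct {i} {j} i<j j<period eq = minimal 0<k k<period per-k
      where
      k : ℕ
      k = i + (period ∸ j)
      0<k : 0 < k
      0<k = <-≤-trans (m<n⇒0<n∸m j<period) (m≤n+m _ i)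
      k<period : k < period
      k<period = begin-strict
        i + (period ∸ j) <⟨ +-monoˡ-< (period ∸ j) i<j ⟩
        j + (period ∸ j) ≡⟨ m+[n∸m]≡n (<⇒≤ j<period) ⟩
        period           ∎
        where open ≤-Reasoning
      per-k : iterate k g x ≡ x
      per-k = begin
        iterate (i + (period ∸ j)) g x           ≡⟨ cong (λ n → iterate n g x) (+-comm i _) ⟩
        iterate ((period ∸ j) + i) g x           ≡⟨ iterate-+ g (period ∸ j) i x ⟩
        iterate (period ∸ j) g (iterate i g x)   ≡⟨ cong (iterate (period ∸ j) g) eq ⟩
        iterate (period ∸ j) g (iterate j g x)   ≡⟨ iterate-+ g (period ∸ j) j x ⟨
        iterate ((period ∸ j) + j) g x           ≡⟨ cong (λ n → iterate n g x) (m∸n+n≡m (<⇒≤ j<period)) ⟩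
        iterate period g x                       ≡⟨ periodic ⟩
        x                                        ∎
        where open ≡-Reasoning

    iterates-period-unique : Unique (iterates g period x)
    iterates-period-unique = distinct⇒unique period x (λ i<j j<n → iterates-period-distinct i<j j<n)
      where
      distinct⇒unique : ∀ n y → (∀ {i j} → i < j → j < n → iterate i g y ≢ iterate j g y) → Unique (iterates g n y)
      distinct⇒unique zero    y distinct = []
      distinct⇒unique (suc n) y distinct =
        All.tabulate head-fresh ∷ distinct⇒unique n (g y) tail-distinct
        where
        head-fresh : ∀ {z} → z ∈ iterates g n (g y) → y ≢ z
        head-fresh z∈ with ∈-iterates⁻ g n (g y) z∈
        ... | k , k<n , refl = λ eq → distinct (s≤s z≤n) (s≤s k<n) (trans eq (iterate-suc g k y))
        tail-distinct : ∀ {i j} → i < j → j < n → iterate i g (g y) ≢ iterate j g (g y)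
        tail-distinct {i} {j} i<j j<n eq =
          distinct (s≤s i<j) (s≤s j<n) (trans (sym (iterate-suc g i y)) (trans eq (iterate-suc g j y)))

  module _ (U : List Labeling) where

    -- Defs.orbit q f is orbitIn (Vec.≡-dec _≟_) (Pro q) (Inc q) f by definition.
    orbitIn : Labeling → List Labeling
    orbitIn x = filterᵇ (λ y → any (λ k → does (iterate k g x ≟ y)) (upTo (suc (length U)))) U

    module _ (U-unique : Unique U) (g-closed : ∀ {y} → y ∈ U → g y ∈ U) {x : Labeling} (x∈U : x ∈ U) where

      iterate-∈ : ∀ k → iterate k g x ∈ U
      iterate-∈ zero    = x∈U
      iterate-∈ (suc k) = g-closed (iterate-∈ k)

      period≤length : (mp : MinimalPeriod x) → MinimalPeriod.period mp ≤ length U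
      period≤length mp with MinimalPeriod.period mp ≤? length U
      ... | yes ≤length = ≤length
      ... | no  ≰length with pigeonhole (≰⇒> ≰length) (λ i → index (iterate-∈ (toℕ i)))
      ...   | i , j , i<j , same-index = contradiction same-element (iterates-period-distinct mp i<j (toℕ<n j))
        where
        same-element : iterate (toℕ i) g x ≡ iterate (toℕ j) g x
        same-element = trans (lookup-index (iterate-∈ (toℕ i)))
                             (trans (cong (List.lookup U) same-index) (sym (lookup-index (iterate-∈ (toℕ j)))))

      ∈-orbitIn⁺ : ∀ {k} → k ≤ length U → iterate k g x ∈ orbitIn x
      ∈-orbitIn⁺ {k} k≤length = ∈-filter⁺ (T? ∘ _) (iterate-∈ k)
        (any⁺ _ (lose (∈-upTo⁺ (s≤s k≤length)) (T-does (iterate k g x ≟ iterate k g x) refl)))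

      ∈-orbitIn⁻ : ∀ {y} → y ∈ orbitIn x → ∃ λ k → iterate k g x ≡ y
      ∈-orbitIn⁻ {y} y∈ with find (any⁻ _ (upTo (suc (length U))) (proj₂ (∈-filter⁻ (T? ∘ _) {xs = U} y∈)))
      ... | k , _ , same = k , does-T (iterate k g x ≟ y) same

      module _ (mp : MinimalPeriod x) where
        open MinimalPeriod mp

        orbitIn↭iterates-period : orbitIn x ↭ iterates g period x
        orbitIn↭iterates-period =
          ∼bag⇒↭ (unique∧set⇒bag (Unique.filter⁺ (T? ∘ _) U-unique) (iterates-period-unique mp) (mk⇔ to from))
          where
          to : ∀ {y} → y ∈ orbitIn x → y ∈ iterates g period x
          to y∈ with ∈-orbitIn⁻ y∈
          ... | k , refl = ∈-iterates-period mp k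
          from : ∀ {y} → y ∈ iterates g period x → y ∈ orbitIn x
          from y∈ with ∈-iterates⁻ g period x y∈
          ... | k , k<period , refl = ∈-orbitIn⁺ (≤-trans (<⇒≤ k<period) (period≤length mp))

      orbit-average : ∀ (η : Labeling → ℕ) {p} → 0 < p → iterate p g x ≡ x →
                      sum (map η (orbitIn x)) * p ≡ sum (map η (iterates g p x)) * length (orbitIn x)
      orbit-average η {p} 0<p per = begin
        sum (map η (orbitIn x)) * p             ≡⟨ cong₂ _*_ (sum-↭ (map⁺ η orbit↭)) p≡m*d ⟩
        S * (m * d)                             ≡⟨ *-assoc S m d ⟨
        S * m * d                               ≡⟨ cong (_* d) (*-comm S m) ⟩
        m * S * d
          ≡⟨ cong₂ _*_ (sum-iterates-* g η periodic m) (trans (↭-length orbit↭) (length-iterates g d x)) ⟨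
        sum (map η (iterates g (m * d) x)) * length (orbitIn x)
          ≡⟨ cong (λ n → sum (map η (iterates g n x)) * length (orbitIn x)) p≡m*d ⟨
        sum (map η (iterates g p x)) * length (orbitIn x) ∎
        where
        open ≡-Reasoning
        mp : MinimalPeriod x
        mp = minimalPeriod p 0<p per
        open MinimalPeriod mp
        d S m : ℕ
        d = period
        S = sum (map η (iterates g d x))
        m = p / d
          where instance _ = >-nonZero 0<period
        p≡m*d : p ≡ m * d
        p≡m*d = period-divides mp per
        orbit↭ : orbitIn x ↭ iterates g d x
        orbit↭ = orbitIn↭iterates-period mp

      orbit-All : ∀ (P : Labeling → Set) {p} → 0 < p → iterate p g x ≡ x →
                  All P (orbitIn x) ⇔ All P (iterates g p x)
      orbit-All P {p} 0<p per = mk⇔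
        (λ all → All.tabulate λ y∈ → All.lookup all (from-iterates y∈))
        (λ all → All.tabulate λ y∈ → All.lookup all (to-iterates y∈))
        where
        mp : MinimalPeriod x
        mp = minimalPeriod p 0<p per
        open MinimalPeriod mp
        from-iterates : ∀ {y} → y ∈ iterates g p x → y ∈ orbitIn x
        from-iterates y∈ with ∈-iterates⁻ g p x y∈
        ... | k , _ , refl = ∈-resp-↭ (↭-sym (orbitIn↭iterates-period mp)) (∈-iterates-period mp k)
        to-iterates : ∀ {y} → y ∈ orbitIn x → y ∈ iterates g p x
        to-iterates y∈ with ∈-iterates⁻ g period x (∈-resp-↭ (orbitIn↭iterates-period mp) y∈)
        ... | k , k<period , refl = ∈-iterates⁺ g x (<-≤-trans k<period (period-≤ mp 0<p per))

map-unique-on : ∀ (h : Labeling → Labeling) {xs} → Unique xs →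
                (∀ {x y} → x ∈ xs → y ∈ xs → h x ≡ h y → x ≡ y) → Unique (map h xs)
map-unique-on h {[]}     []          injective = []
map-unique-on h {x ∷ xs} (x∉ ∷ xs!) injective =
  All.map⁺ (All.tabulate (λ y∈ hx≡hy → All.lookup x∉ y∈ (injective (here refl) (there y∈) hx≡hy)))
  ∷ map-unique-on h xs! (λ x∈ y∈ → injective (there x∈) (there y∈))

sum-pairs : ∀ (η : Labeling → ℕ) (ι : Labeling → Labeling) c xs → (∀ {f} → f ∈ xs → η f + η (ι f) ≡ c) →
            sum (map η xs) + sum (map (η ∘ ι) xs) ≡ c * length xs
sum-pairs η ι c []       pairs = sym (*-zeroʳ c)
sum-pairs η ι c (f ∷ xs) pairs = begin
  (η f + sum (map η xs)) + (η (ι f) + sum (map (η ∘ ι) xs)) ≡⟨ interchange (η f) _ _ _ ⟩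
  (η f + η (ι f)) + (sum (map η xs) + sum (map (η ∘ ι) xs))
    ≡⟨ cong₂ _+_ (pairs (here refl)) (sum-pairs η ι c xs (pairs ∘ there)) ⟩
  c + c * length xs                                         ≡⟨ *-suc c (length xs) ⟨
  c * length (f ∷ xs)                                       ∎
  where open ≡-Reasoning

sum-involution : ∀ (η : Labeling → ℕ) (ι : Labeling → Labeling) c {U} → Unique U →
  (∀ {f} → f ∈ U → ι f ∈ U) → (∀ {f} → f ∈ U → ι (ι f) ≡ f) → (∀ {f} → f ∈ U → η f + η (ι f) ≡ c) →
  sum (map η U) + sum (map η U) ≡ c * length U
sum-involution η ι c {U} U! ι-closed ι-involutive pairs = begin
  sum (map η U) + sum (map η U)       ≡⟨ cong (sum (map η U) +_) (sum-↭ (map⁺ η ι-permutes)) ⟨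
  sum (map η U) + sum (map η (map ι U)) ≡⟨ cong (λ l → sum (map η U) + sum l) (map-∘ U) ⟨
  sum (map η U) + sum (map (η ∘ ι) U) ≡⟨ sum-pairs η ι c U pairs ⟩
  c * length U                        ∎
  where
  open ≡-Reasoning
  ι-permutes : map ι U ↭ U
  ι-permutes = ∼bag⇒↭ (unique∧set⇒bag (map-unique-on ι U! ι-injective) U! (mk⇔ to from))
    where
    to : ∀ {g} → g ∈ map ι U → g ∈ U
    to g∈ with ∈-map⁻ ι g∈
    ... | f , f∈ , refl = ι-closed f∈
    from : ∀ {g} → g ∈ U → g ∈ map ι U
    from g∈ = subst (_∈ map ι U) (ι-involutive g∈) (∈-map⁺ ι (ι-closed g∈))
    ι-injective : ∀ {f g} → f ∈ U → g ∈ U → ι f ≡ ι g → f ≡ g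
    ι-injective f∈ g∈ eq = trans (sym (ι-involutive f∈)) (trans (cong ι eq) (ι-involutive g∈))

-- Promotion on Z₄, computed in the cases that occur

≡ᵇ-refl : ∀ n → (n ≡ᵇ n) ≡ true
≡ᵇ-refl n = Equivalence.to T-≡ (≡⇒≡ᵇ n n refl)

≢⇒≡ᵇ-false : ∀ {m n} → m ≢ n → (m ≡ᵇ n) ≡ false
≢⇒≡ᵇ-false {m} {n} m≢n with m ≡ᵇ n in eq
... | false = refl
... | true  = contradiction (≡ᵇ⇒≡ m n (subst T (sym eq) _)) m≢n

≤ᵇ-true : ∀ {m n} → m ≤ n → (m ≤ᵇ n) ≡ true
≤ᵇ-true m≤n = Equivalence.to T-≡ (≤⇒≤ᵇ m≤n)

≤ᵇ-false : ∀ {m n} → n < m → (m ≤ᵇ n) ≡ false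
≤ᵇ-false {m} {n} n<m with m ≤ᵇ n in eq
... | false = refl
... | true  = contradiction (≤ᵇ⇒≤ m n (subst T (sym eq) _)) (<⇒≱ n<m)

Idle : ℕ → State → Set
Idle i s = slide i s ≡ s

slide-idle-minima-filled : ∀ i a c s₂ s₄ → Idle i (just a ∷ s₂ ∷ just c ∷ s₄ ∷ [])
slide-idle-minima-filled i a c nothing  nothing
  rewrite ∧-zeroʳ (a ≡ᵇ i) | ∧-zeroʳ (c ≡ᵇ i) = refl
slide-idle-minima-filled i a c nothing  (just d)
  rewrite ∧-zeroʳ (a ≡ᵇ i) | ∧-zeroʳ (c ≡ᵇ i) | ∧-zeroʳ (d ≡ᵇ i) = refl
slide-idle-minima-filled i a c (just b) nothing
  rewrite ∧-zeroʳ (a ≡ᵇ i) | ∧-zeroʳ (c ≡ᵇ i) | ∧-zeroʳ (b ≡ᵇ i) = refl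
slide-idle-minima-filled i a c (just b) (just d)
  rewrite ∧-zeroʳ (a ≡ᵇ i) | ∧-zeroʳ (c ≡ᵇ i) | ∧-zeroʳ (b ≡ᵇ i) | ∧-zeroʳ (d ≡ᵇ i) = refl

slide-idle-x₃-filled : ∀ {i b} s₁ c s₄ → b ≢ i → Idle i (s₁ ∷ just b ∷ just c ∷ s₄ ∷ [])
slide-idle-x₃-filled {i} {b} nothing  c nothing  b≢i rewrite ≢⇒≡ᵇ-false b≢i | ∧-zeroʳ (c ≡ᵇ i) = refl
slide-idle-x₃-filled {i} {b} nothing  c (just d) b≢i rewrite ≢⇒≡ᵇ-false b≢i | ∧-zeroʳ (c ≡ᵇ i) | ∧-zeroʳ (d ≡ᵇ i) = refl
slide-idle-x₃-filled {i} {b} (just a) c nothing  b≢i rewrite ≢⇒≡ᵇ-false b≢i | ∧-zeroʳ (a ≡ᵇ i) | ∧-zeroʳ (c ≡ᵇ i) = refl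
slide-idle-x₃-filled {i} {b} (just a) c (just d) b≢i
  rewrite ≢⇒≡ᵇ-false b≢i | ∧-zeroʳ (a ≡ᵇ i) | ∧-zeroʳ (c ≡ᵇ i) | ∧-zeroʳ (d ≡ᵇ i) = refl

slide-idle-maxima-unmatched : ∀ {i b d} s₁ s₃ → b ≢ i → d ≢ i → Idle i (s₁ ∷ just b ∷ s₃ ∷ just d ∷ [])
slide-idle-maxima-unmatched {i} nothing  nothing  b≢i d≢i rewrite ≢⇒≡ᵇ-false b≢i | ≢⇒≡ᵇ-false d≢i = refl
slide-idle-maxima-unmatched {i} nothing  (just c) b≢i d≢i
  rewrite ≢⇒≡ᵇ-false b≢i | ≢⇒≡ᵇ-false d≢i | ∧-zeroʳ (c ≡ᵇ i) = refl
slide-idle-maxima-unmatched {i} (just a) nothing  b≢i d≢i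
  rewrite ≢⇒≡ᵇ-false b≢i | ≢⇒≡ᵇ-false d≢i | ∧-zeroʳ (a ≡ᵇ i) = refl
slide-idle-maxima-unmatched {i} (just a) (just c) b≢i d≢i
  rewrite ≢⇒≡ᵇ-false b≢i | ≢⇒≡ᵇ-false d≢i | ∧-zeroʳ (a ≡ᵇ i) | ∧-zeroʳ (c ≡ᵇ i) = refl

countFrom : ℕ → ℕ → List ℕ
countFrom lo zero    = []
countFrom lo (suc n) = lo ∷ countFrom (suc lo) n

applyUpTo≡countFrom : ∀ n lo (f : ℕ → ℕ) → (∀ k → f k ≡ lo + k) → applyUpTo f n ≡ countFrom lo n
applyUpTo≡countFrom zero    lo f f≗ = refl
applyUpTo≡countFrom (suc n) lo f f≗ =
  cong₂ _∷_ (trans (f≗ 0) (+-identityʳ lo)) (applyUpTo≡countFrom n (suc lo) (f ∘ suc) (λ k → trans (f≗ (suc k)) (+-suc lo k)))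

runSlides : State → List ℕ → State
runSlides = foldl (λ s i → slide i s)

boxOnes : Labeling → State
boxOnes = Vec.map (λ v → if v ≡ᵇ 1 then nothing else just v)

unbox : ℕ → State → Labeling
unbox q = Vec.map (maybe (λ v → v ∸ 1) q)

Pro≡runSlides : ∀ q f → Pro q f ≡ unbox q (runSlides (boxOnes f) (countFrom 2 (q ∸ 1)))
Pro≡runSlides q f = cong (λ is → unbox q (runSlides (boxOnes f) is))
                         (trans (map-upTo (2 +_) (q ∸ 1)) (applyUpTo≡countFrom (q ∸ 1) 2 (2 +_) (λ _ → refl)))

runSlides-idle : ∀ {s} is → (∀ i → Idle i s) → runSlides s is ≡ s
runSlides-idle []       idle = refl
runSlides-idle (i ∷ is) idle rewrite idle i = runSlides-idle is idle

runSlides-event : ∀ lo k n {s} → (∀ i → i < lo + k → Idle i s) →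
                  runSlides s (countFrom lo (k + suc n)) ≡ runSlides (slide (lo + k) s) (countFrom (suc (lo + k)) n)
runSlides-event lo zero    n idle rewrite +-identityʳ lo = refl
runSlides-event lo (suc k) n {s} idle rewrite idle lo (m<m+n lo (s≤s z≤n)) | +-suc lo k =
  runSlides-event (suc lo) k n idle

-- Slides below the event value leave the boxes in place, the event lifts them to maximal
-- elements, and from then on both minimal elements are filled, so no later slide moves anything.
Pro-single-event : ∀ {q f s} k → 2 + k ≤ q → (∀ i → i < 2 + k → Idle i (boxOnes f)) →
                slide (2 + k) (boxOnes f) ≡ s → (∀ i → Idle i s) → Pro q f ≡ unbox q s
Pro-single-event {q} {f} {s} k b≤q idle event idle-after with m≤n⇒∃[o]m+o≡n b≤q
... | r , refl = begin
  Pro q f                                                         ≡⟨ Pro≡runSlides q f ⟩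
  unbox q (runSlides (boxOnes f) (countFrom 2 (suc (k + r))))
    ≡⟨ cong (λ n → unbox q (runSlides (boxOnes f) (countFrom 2 n))) (+-suc k r) ⟨
  unbox q (runSlides (boxOnes f) (countFrom 2 (k + suc r)))
    ≡⟨ cong (unbox q) (runSlides-event 2 k r idle) ⟩
  unbox q (runSlides (slide (2 + k) (boxOnes f)) (countFrom (3 + k) r))
    ≡⟨ cong (λ t → unbox q (runSlides t (countFrom (3 + k) r))) event ⟩
  unbox q (runSlides s (countFrom (3 + k) r))
    ≡⟨ cong (unbox q) (runSlides-idle (countFrom (3 + k) r) idle-after) ⟩
  unbox q s                                                       ∎
  where open ≡-Reasoning

Pro-without-ones : ∀ q a b c d → Pro q (2 + a ∷ 2 + b ∷ 2 + c ∷ 2 + d ∷ []) ≡ (1 + a ∷ 1 + b ∷ 1 + c ∷ 1 + d ∷ [])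
Pro-without-ones q a b c d = begin
  Pro q (2 + a ∷ 2 + b ∷ 2 + c ∷ 2 + d ∷ [])
    ≡⟨ Pro≡runSlides q (2 + a ∷ 2 + b ∷ 2 + c ∷ 2 + d ∷ []) ⟩
  unbox q (runSlides (boxOnes (2 + a ∷ 2 + b ∷ 2 + c ∷ 2 + d ∷ [])) (countFrom 2 (q ∸ 1)))
    ≡⟨ cong (unbox q) (runSlides-idle (countFrom 2 (q ∸ 1))
                        (λ i → slide-idle-minima-filled i (2 + a) (2 + c) (just (2 + b)) (just (2 + d)))) ⟩
  (1 + a ∷ 1 + b ∷ 1 + c ∷ 1 + d ∷ [])                          ∎
  where open ≡-Reasoning

<⇒≢ʳ : ∀ {m n} → m < n → n ≢ m
<⇒≢ʳ m<n = ≢-sym (<⇒≢ m<n)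

Pro-one-at-x₁ : ∀ q b c d → 2 + b ≤ q →
  Pro q (1 ∷ 2 + b ∷ 2 + c ∷ 2 + d ∷ []) ≡ (1 + b ∷ q ∷ 1 + c ∷ 1 + d ∷ [])
Pro-one-at-x₁ q b c d b≤q = Pro-single-event {f = 1 ∷ 2 + b ∷ 2 + c ∷ 2 + d ∷ []} b b≤q
  (λ i i<b → slide-idle-x₃-filled nothing (2 + c) (just (2 + d)) (<⇒≢ʳ i<b)) event
  (λ i → slide-idle-minima-filled i _ _ _ _)
  where
  event : slide (2 + b) (nothing ∷ just (2 + b) ∷ just (2 + c) ∷ just (2 + d) ∷ [])
        ≡ (just (2 + b) ∷ nothing ∷ just (2 + c) ∷ just (2 + d) ∷ [])
  event rewrite ≡ᵇ-refl b | ∧-zeroʳ (c ≡ᵇ b) | ∧-zeroʳ (d ≡ᵇ b) = refl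

Pro-one-at-x₃-b<d : ∀ q a b d → 2 + b ≤ q → b < d →
  Pro q (2 + a ∷ 2 + b ∷ 1 ∷ 2 + d ∷ []) ≡ (1 + a ∷ q ∷ 1 + b ∷ 1 + d ∷ [])
Pro-one-at-x₃-b<d q a b d b≤q b<d = Pro-single-event {f = 2 + a ∷ 2 + b ∷ 1 ∷ 2 + d ∷ []} b b≤q
  (λ i i<b → slide-idle-maxima-unmatched (just (2 + a)) nothing (<⇒≢ʳ i<b) (<⇒≢ʳ (<-trans i<b (s≤s (s≤s b<d))))) event
  (λ i → slide-idle-minima-filled i _ _ _ _)
  where
  event : slide (2 + b) (just (2 + a) ∷ just (2 + b) ∷ nothing ∷ just (2 + d) ∷ [])
        ≡ (just (2 + a) ∷ nothing ∷ just (2 + b) ∷ just (2 + d) ∷ [])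
  event rewrite ≡ᵇ-refl b | ∧-zeroʳ (a ≡ᵇ b) | ≢⇒≡ᵇ-false (<⇒≢ʳ b<d) = refl

Pro-one-at-x₃-d<b : ∀ q a b d → 2 + d ≤ q → d < b →
  Pro q (2 + a ∷ 2 + b ∷ 1 ∷ 2 + d ∷ []) ≡ (1 + a ∷ 1 + b ∷ 1 + d ∷ q ∷ [])
Pro-one-at-x₃-d<b q a b d d≤q d<b = Pro-single-event {f = 2 + a ∷ 2 + b ∷ 1 ∷ 2 + d ∷ []} d d≤q
  (λ i i<d → slide-idle-maxima-unmatched (just (2 + a)) nothing (<⇒≢ʳ (<-trans i<d (s≤s (s≤s d<b)))) (<⇒≢ʳ i<d)) event
  (λ i → slide-idle-minima-filled i _ _ _ _)
  where
  event : slide (2 + d) (just (2 + a) ∷ just (2 + b) ∷ nothing ∷ just (2 + d) ∷ [])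
        ≡ (just (2 + a) ∷ just (2 + b) ∷ just (2 + d) ∷ nothing ∷ [])
  event rewrite ≡ᵇ-refl d | ∧-zeroʳ (a ≡ᵇ d) | ≢⇒≡ᵇ-false (<⇒≢ʳ d<b) = refl

Pro-one-at-x₃-b≡d : ∀ q a b → 2 + b ≤ q →
  Pro q (2 + a ∷ 2 + b ∷ 1 ∷ 2 + b ∷ []) ≡ (1 + a ∷ q ∷ 1 + b ∷ q ∷ [])
Pro-one-at-x₃-b≡d q a b b≤q = Pro-single-event {f = 2 + a ∷ 2 + b ∷ 1 ∷ 2 + b ∷ []} b b≤q
  (λ i i<b → slide-idle-maxima-unmatched (just (2 + a)) nothing (<⇒≢ʳ i<b) (<⇒≢ʳ i<b)) event
  (λ i → slide-idle-minima-filled i _ _ _ _)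
  where
  event : slide (2 + b) (just (2 + a) ∷ just (2 + b) ∷ nothing ∷ just (2 + b) ∷ [])
        ≡ (just (2 + a) ∷ nothing ∷ just (2 + b) ∷ nothing ∷ [])
  event rewrite ≡ᵇ-refl b | ∧-zeroʳ (a ≡ᵇ b) = refl

Pro-ones-at-x₁x₃-b<d : ∀ q b d → 2 + b ≤ q → b < d →
  Pro q (1 ∷ 2 + b ∷ 1 ∷ 2 + d ∷ []) ≡ (1 + b ∷ q ∷ 1 + b ∷ 1 + d ∷ [])
Pro-ones-at-x₁x₃-b<d q b d b≤q b<d = Pro-single-event {f = 1 ∷ 2 + b ∷ 1 ∷ 2 + d ∷ []} b b≤q
  (λ i i<b → slide-idle-maxima-unmatched nothing nothing (<⇒≢ʳ i<b) (<⇒≢ʳ (<-trans i<b (s≤s (s≤s b<d))))) event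
  (λ i → slide-idle-minima-filled i _ _ _ _)
  where
  event : slide (2 + b) (nothing ∷ just (2 + b) ∷ nothing ∷ just (2 + d) ∷ [])
        ≡ (just (2 + b) ∷ nothing ∷ just (2 + b) ∷ just (2 + d) ∷ [])
  event rewrite ≡ᵇ-refl b | ≢⇒≡ᵇ-false (<⇒≢ʳ b<d) = refl

Pro-ones-at-x₁x₃-b≡d : ∀ q b → 2 + b ≤ q →
  Pro q (1 ∷ 2 + b ∷ 1 ∷ 2 + b ∷ []) ≡ (1 + b ∷ q ∷ 1 + b ∷ q ∷ [])
Pro-ones-at-x₁x₃-b≡d q b b≤q = Pro-single-event {f = 1 ∷ 2 + b ∷ 1 ∷ 2 + b ∷ []} b b≤q
  (λ i i<b → slide-idle-maxima-unmatched nothing nothing (<⇒≢ʳ i<b) (<⇒≢ʳ i<b)) event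
  (λ i → slide-idle-minima-filled i _ _ _ _)
  where
  event : slide (2 + b) (nothing ∷ just (2 + b) ∷ nothing ∷ just (2 + b) ∷ [])
        ≡ (just (2 + b) ∷ nothing ∷ just (2 + b) ∷ nothing ∷ [])
  event rewrite ≡ᵇ-refl b = refl

Pro-ones-at-x₁x₃-d<b : ∀ q b d → 2 + b ≤ q → d < b →
  Pro q (1 ∷ 2 + b ∷ 1 ∷ 2 + d ∷ []) ≡ (1 + b ∷ q ∷ 1 + d ∷ q ∷ [])
Pro-ones-at-x₁x₃-d<b q b d b≤q d<b with m≤n⇒∃[o]m+o≡n d<b
... | m , refl with m≤n⇒∃[o]m+o≡n b≤q
... | r , refl = begin
  Pro q (1 ∷ 2 + b ∷ 1 ∷ 2 + d ∷ [])                    ≡⟨ Pro≡runSlides q (1 ∷ 2 + b ∷ 1 ∷ 2 + d ∷ []) ⟩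
  unbox q (runSlides s₀ (countFrom 2 (q ∸ 1)))
    ≡⟨ cong (λ n → unbox q (runSlides s₀ (countFrom 2 n))) (slide-count d m r) ⟩
  unbox q (runSlides s₀ (countFrom 2 (d + suc (m + suc r))))
    ≡⟨ cong (unbox q) (runSlides-event 2 d (m + suc r) first-idle) ⟩
  unbox q (runSlides (slide (2 + d) s₀) (countFrom (3 + d) (m + suc r)))
    ≡⟨ cong (λ t → unbox q (runSlides t (countFrom (3 + d) (m + suc r)))) first-event ⟩
  unbox q (runSlides s₁ (countFrom (3 + d) (m + suc r)))
    ≡⟨ cong (unbox q) (runSlides-event (3 + d) m r second-idle) ⟩
  unbox q (runSlides (slide (2 + b) s₁) (countFrom (3 + b) r))
    ≡⟨ cong (λ t → unbox q (runSlides t (countFrom (3 + b) r))) second-event ⟩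
  unbox q (runSlides s₂ (countFrom (3 + b) r))
    ≡⟨ cong (unbox q) (runSlides-idle (countFrom (3 + b) r) (λ i → slide-idle-minima-filled i _ _ _ _)) ⟩
  unbox q s₂                                            ∎
  where
  open ≡-Reasoning
  s₀ s₁ s₂ : State
  s₀ = nothing ∷ just (2 + b) ∷ nothing ∷ just (2 + d) ∷ []
  s₁ = nothing ∷ just (2 + b) ∷ just (2 + d) ∷ nothing ∷ []
  s₂ = just (2 + b) ∷ nothing ∷ just (2 + d) ∷ nothing ∷ []
  slide-count : ∀ d m r → suc (suc d + m) + r ≡ d + suc (m + suc r)
  slide-count = solve-∀
  first-idle : ∀ i → i < 2 + d → Idle i s₀
  first-idle i i<d = slide-idle-maxima-unmatched nothing nothing (<⇒≢ʳ (<-trans i<d (s≤s (s≤s d<b)))) (<⇒≢ʳ i<d)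
  first-event : slide (2 + d) s₀ ≡ s₁
  first-event rewrite ≡ᵇ-refl d | ≢⇒≡ᵇ-false (<⇒≢ʳ d<b) = refl
  second-idle : ∀ i → i < 2 + b → Idle i s₁
  second-idle i i<b = slide-idle-x₃-filled nothing (2 + d) nothing (<⇒≢ʳ i<b)
  second-event : slide (2 + b) s₁ ≡ s₂
  second-event rewrite ≡ᵇ-refl b | ∧-zeroʳ (d ≡ᵇ b) = refl

-- The set Inc^q(Z₄)

concatMap-unique : ∀ {A B : Set} (h : A → List B) (key : B → A) {xs} → Unique xs → (∀ x → Unique (h x)) →
                   (∀ {x y} → y ∈ h x → key y ≡ x) → Unique (concatMap h xs)
concatMap-unique h key {[]}     []          h-unique keyed = []
concatMap-unique h key {x ∷ xs} (x∉ ∷ xs!) h-unique keyed =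
  Unique.++⁺ (h-unique x) (concatMap-unique h key xs! h-unique keyed) disjoint
  where
  disjoint : ∀ {y} → ¬ (y ∈ h x × y ∈ concatMap h xs)
  disjoint (y∈hx , y∈rest) with find (∈-concatMap⁻ h {xs = xs} y∈rest)
  ... | x′ , x′∈xs , y∈hx′ = All.lookup x∉ x′∈xs (trans (sym (keyed y∈hx)) (keyed y∈hx′))

∈-range : ∀ {q x} → x ∈ range q ⇔ (1 ≤ x × x ≤ q)
∈-range {q} = mk⇔ to from
  where
  to : ∀ {x} → x ∈ range q → 1 ≤ x × x ≤ q
  to x∈ with ∈-map⁻ suc x∈
  ... | y , y∈ , refl = s≤s z≤n , ∈-upTo⁻ y∈
  from : ∀ {x} → 1 ≤ x × x ≤ q → x ∈ range q
  from {suc y} (_ , y<q) = ∈-map⁺ suc (∈-upTo⁺ y<q)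

Increasing : ℕ → Labeling → Set
Increasing q (a ∷ b ∷ c ∷ d ∷ []) = 1 ≤ a × a < b × 1 ≤ c × c < b × c < d × b ≤ q × d ≤ q

labelings₃ : ℕ → ℕ → ℕ → ℕ → List Labeling
labelings₃ q a b c = map (λ d → a ∷ b ∷ c ∷ d ∷ []) (range q)

labelings₂ : ℕ → ℕ → ℕ → List Labeling
labelings₂ q a b = concatMap (labelings₃ q a b) (range q)

labelings₁ : ℕ → ℕ → List Labeling
labelings₁ q a = concatMap (labelings₂ q a) (range q)

InRange : ℕ → Labeling → Set
InRange q (a ∷ b ∷ c ∷ d ∷ []) = a ∈ range q × b ∈ range q × c ∈ range q × d ∈ range q

∈-allLabelings⁻ : ∀ {q f} → f ∈ allLabelings q → InRange q f
∈-allLabelings⁻ {q} f∈ with find (∈-concatMap⁻ (labelings₁ q) {xs = range q} f∈)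
... | a , a∈ , f∈₁ with find (∈-concatMap⁻ (labelings₂ q a) {xs = range q} f∈₁)
... | b , b∈ , f∈₂ with find (∈-concatMap⁻ (labelings₃ q a b) {xs = range q} f∈₂)
... | c , c∈ , f∈₃ with ∈-map⁻ (λ d → a ∷ b ∷ c ∷ d ∷ []) f∈₃
... | d , d∈ , refl = a∈ , b∈ , c∈ , d∈

∈-allLabelings⁺ : ∀ {q} f → InRange q f → f ∈ allLabelings q
∈-allLabelings⁺ {q} (a ∷ b ∷ c ∷ d ∷ []) (a∈ , b∈ , c∈ , d∈) =
  ∈-concatMap⁺ (labelings₁ q) {xs = range q} (lose a∈ (∈-concatMap⁺ (labelings₂ q a) {xs = range q} (lose b∈
    (∈-concatMap⁺ (labelings₃ q a b) {xs = range q} (lose c∈ (∈-map⁺ (λ d → a ∷ b ∷ c ∷ d ∷ []) d∈))))))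

T-isIncreasingᵇ : ∀ a b c d → T (isIncreasingᵇ (a ∷ b ∷ c ∷ d ∷ [])) ⇔ (a < b × c < b × c < d)
T-isIncreasingᵇ a b c d = mk⇔ to from
  where
  to : T (isIncreasingᵇ (a ∷ b ∷ c ∷ d ∷ [])) → a < b × c < b × c < d
  to t with Equivalence.to T-∧ t
  ... | a<b , rest with Equivalence.to T-∧ rest
  ... | c<b , c<d = ≤ᵇ⇒≤ _ _ a<b , ≤ᵇ⇒≤ _ _ c<b , ≤ᵇ⇒≤ _ _ c<d
  from : a < b × c < b × c < d → T (isIncreasingᵇ (a ∷ b ∷ c ∷ d ∷ []))
  from (a<b , c<b , c<d) = Equivalence.from T-∧ (≤⇒≤ᵇ a<b , Equivalence.from T-∧ (≤⇒≤ᵇ c<b , ≤⇒≤ᵇ c<d))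

∈Inc⇔Increasing : ∀ {q} f → f ∈ Inc q ⇔ Increasing q f
∈Inc⇔Increasing {q} f = mk⇔ (to f) (from f)
  where
  to : ∀ f → f ∈ Inc q → Increasing q f
  to (a ∷ b ∷ c ∷ d ∷ []) f∈ with ∈-filter⁻ (T? ∘ isIncreasingᵇ) {xs = allLabelings q} f∈
  ... | f∈all , incr with ∈-allLabelings⁻ f∈all | Equivalence.to (T-isIncreasingᵇ a b c d) incr
  ... | a∈ , b∈ , c∈ , d∈ | a<b , c<b , c<d = lower a∈ , a<b , lower c∈ , c<b , c<d , upper b∈ , upper d∈
    where
    lower : ∀ {x} → x ∈ range q → 1 ≤ x
    lower = proj₁ ∘ Equivalence.to ∈-range
    upper : ∀ {x} → x ∈ range q → x ≤ q
    upper = proj₂ ∘ Equivalence.to ∈-range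
  from : ∀ f → Increasing q f → f ∈ Inc q
  from (a ∷ b ∷ c ∷ d ∷ []) (1≤a , a<b , 1≤c , c<b , c<d , b≤q , d≤q) =
    ∈-filter⁺ (T? ∘ isIncreasingᵇ)
      (∈-allLabelings⁺ _ (in-range 1≤a (≤-trans (<⇒≤ a<b) b≤q) , in-range (≤-trans 1≤a (<⇒≤ a<b)) b≤q ,
                          in-range 1≤c (≤-trans (<⇒≤ c<b) b≤q) , in-range (≤-trans 1≤c (<⇒≤ c<d)) d≤q))
      (Equivalence.from (T-isIncreasingᵇ a b c d) (a<b , c<b , c<d))
    where
    in-range : ∀ {x} → 1 ≤ x → x ≤ q → x ∈ range q
    in-range 1≤x x≤q = Equivalence.from ∈-range (1≤x , x≤q)

range-unique : ∀ q → Unique (range q)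
range-unique q = Unique.map⁺ suc-injective (Unique.upTo⁺ q)

Inc-unique : ∀ q → Unique (Inc q)
Inc-unique q = Unique.filter⁺ (T? ∘ isIncreasingᵇ)
  (concatMap-unique (labelings₁ q) (λ f → lookup f x₁) (range-unique q) unique₁ keyed₁)
  where
  R! : Unique (range q)
  R! = range-unique q
  unique₃ : ∀ a b c → Unique (labelings₃ q a b c)
  unique₃ a b c = Unique.map⁺ (cong (λ f → lookup f x₄)) R!
  keyed₃ : ∀ {a b c f} → f ∈ labelings₃ q a b c → lookup f x₃ ≡ c
  keyed₃ {a} {b} {c} f∈ with ∈-map⁻ (λ d → a ∷ b ∷ c ∷ d ∷ []) f∈
  ... | _ , _ , refl = refl
  unique₂ : ∀ a b → Unique (labelings₂ q a b)
  unique₂ a b = concatMap-unique (labelings₃ q a b) (λ f → lookup f x₃) R! (unique₃ a b) keyed₃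
  keyed₂ : ∀ {a b f} → f ∈ labelings₂ q a b → lookup f x₂ ≡ b
  keyed₂ {a} {b} f∈ with find (∈-concatMap⁻ (labelings₃ q a b) {xs = range q} f∈)
  ... | c , _ , f∈₃ with ∈-map⁻ (λ d → a ∷ b ∷ c ∷ d ∷ []) f∈₃
  ... | _ , _ , refl = refl
  unique₁ : ∀ a → Unique (labelings₁ q a)
  unique₁ a = concatMap-unique (labelings₂ q a) (λ f → lookup f x₂) R! (unique₂ a) keyed₂
  keyed₁ : ∀ {a f} → f ∈ labelings₁ q a → lookup f x₁ ≡ a
  keyed₁ {a} f∈ with find (∈-concatMap⁻ (labelings₂ q a) {xs = range q} f∈)
  ... | b , _ , f∈₂ with find (∈-concatMap⁻ (labelings₃ q a b) {xs = range q} f∈₂)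
  ... | c , _ , f∈₃ with ∈-map⁻ (λ d → a ∷ b ∷ c ∷ d ∷ []) f∈₃
  ... | _ , _ , refl = refl

Pro-Increasing : ∀ q f → Increasing q f → Increasing q (Pro q f)
Pro-Increasing q (2+ a ∷ 2+ b ∷ 2+ c ∷ 2+ d ∷ []) (_ , a<b , _ , c<b , c<d , b≤q , d≤q)
  rewrite Pro-without-ones q a b c d =
  s≤s z≤n , ≤-pred a<b , s≤s z≤n , ≤-pred c<b , ≤-pred c<d , ≤-trans (n≤1+n _) b≤q , ≤-trans (n≤1+n _) d≤q
Pro-Increasing q (1 ∷ 2+ b ∷ 2+ c ∷ 2+ d ∷ []) (_ , _ , _ , c<b , c<d , b≤q , d≤q)
  rewrite Pro-one-at-x₁ q b c d b≤q =
  s≤s z≤n , b≤q , s≤s z≤n , ≤-trans (<⇒≤ c<b) b≤q , ≤-pred c<d , ≤-refl , ≤-trans (n≤1+n _) d≤q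
Pro-Increasing q (2+ a ∷ 2+ b ∷ 1 ∷ 2+ d ∷ []) (_ , a<b , _ , _ , _ , b≤q , d≤q) with <-cmp b d
... | tri< b<d _ _ rewrite Pro-one-at-x₃-b<d q a b d b≤q b<d =
  s≤s z≤n , ≤-trans (<⇒≤ a<b) b≤q , s≤s z≤n , b≤q , s≤s b<d , ≤-refl , ≤-trans (n≤1+n _) d≤q
... | tri≈ _ refl _ rewrite Pro-one-at-x₃-b≡d q a b b≤q =
  s≤s z≤n , ≤-trans (<⇒≤ a<b) b≤q , s≤s z≤n , b≤q , b≤q , ≤-refl , ≤-refl
... | tri> _ _ d<b rewrite Pro-one-at-x₃-d<b q a b d d≤q d<b =
  s≤s z≤n , ≤-pred a<b , s≤s z≤n , s≤s d<b , d≤q , ≤-trans (n≤1+n _) b≤q , ≤-refl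
Pro-Increasing q (1 ∷ 2+ b ∷ 1 ∷ 2+ d ∷ []) (_ , _ , _ , _ , _ , b≤q , d≤q) with <-cmp b d
... | tri< b<d _ _ rewrite Pro-ones-at-x₁x₃-b<d q b d b≤q b<d =
  s≤s z≤n , b≤q , s≤s z≤n , b≤q , s≤s b<d , ≤-refl , ≤-trans (n≤1+n _) d≤q
... | tri≈ _ refl _ rewrite Pro-ones-at-x₁x₃-b≡d q b b≤q =
  s≤s z≤n , b≤q , s≤s z≤n , b≤q , b≤q , ≤-refl , ≤-refl
... | tri> _ _ d<b rewrite Pro-ones-at-x₁x₃-d<b q b d b≤q d<b =
  s≤s z≤n , b≤q , s≤s z≤n , d≤q , d≤q , ≤-refl , ≤-refl
Pro-Increasing q (0 ∷ _ ∷ _ ∷ _ ∷ []) (() , _)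
Pro-Increasing q (_ ∷ _ ∷ 0 ∷ _ ∷ []) (_ , _ , () , _)
Pro-Increasing q (_ ∷ 0 ∷ _ ∷ _ ∷ []) (_ , () , _)
Pro-Increasing q (1 ∷ 1 ∷ _ ∷ _ ∷ []) (_ , s≤s () , _)
Pro-Increasing q (2+ _ ∷ 1 ∷ _ ∷ _ ∷ []) (_ , s≤s () , _)
Pro-Increasing q (_ ∷ _ ∷ _ ∷ 0 ∷ []) (_ , _ , _ , _ , () , _)
Pro-Increasing q (_ ∷ _ ∷ 1 ∷ 1 ∷ []) (_ , _ , _ , _ , s≤s () , _)
Pro-Increasing q (_ ∷ _ ∷ 2+ _ ∷ 1 ∷ []) (_ , _ , _ , _ , s≤s () , _)

-- Labelings with minimum 1: shapes and gaps

raise : ℕ → Labeling → Labeling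
raise j = Vec.map (j +_)

Positive : Labeling → Set
Positive = VecAll.All (1 ≤_)

Pro-raise : ∀ q j e → Positive e → Pro q (raise (suc j) e) ≡ raise j e
Pro-raise q j (suc a ∷ suc b ∷ suc c ∷ suc d ∷ []) (s≤s _ ∷ s≤s _ ∷ s≤s _ ∷ s≤s _ ∷ [])
  rewrite +-suc j a | +-suc j b | +-suc j c | +-suc j d =
  Pro-without-ones q (j + a) (j + b) (j + c) (j + d)

-- A shape is the standardised word f(x₁)f(x₂)f(x₃)f(x₄) of a labeling with k distinct values.
-- `labeling s hs` has shape s, minimum 1, and consecutive distinct values 1 + hᵢ apart.
data Shape : ℕ → Set where
  s1324 s2413 s1423 s3412 s2314 : Shape 4
  s1213 s1312 s2312 s1323 s2313 : Shape 3
  s1212                         : Shape 2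

ranks : ∀ {k} → Shape k → Vec (Fin k) 4
ranks s1324 = # 0 ∷ # 2 ∷ # 1 ∷ # 3 ∷ []
ranks s2413 = # 1 ∷ # 3 ∷ # 0 ∷ # 2 ∷ []
ranks s1423 = # 0 ∷ # 3 ∷ # 1 ∷ # 2 ∷ []
ranks s3412 = # 2 ∷ # 3 ∷ # 0 ∷ # 1 ∷ []
ranks s2314 = # 1 ∷ # 2 ∷ # 0 ∷ # 3 ∷ []
ranks s1213 = # 0 ∷ # 1 ∷ # 0 ∷ # 2 ∷ []
ranks s1312 = # 0 ∷ # 2 ∷ # 0 ∷ # 1 ∷ []
ranks s2312 = # 1 ∷ # 2 ∷ # 0 ∷ # 1 ∷ []
ranks s1323 = # 0 ∷ # 2 ∷ # 1 ∷ # 2 ∷ []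
ranks s2313 = # 1 ∷ # 2 ∷ # 0 ∷ # 2 ∷ []
ranks s1212 = # 0 ∷ # 1 ∷ # 0 ∷ # 1 ∷ []

next : ∀ {k} → Shape k → Shape k
next s1324 = s2413
next s2413 = s1324
next s1423 = s3412
next s3412 = s2314
next s2314 = s1423
next s1213 = s1312
next s1312 = s2313
next s2313 = s1323
next s1323 = s2312
next s2312 = s1213
next s1212 = s1212

arrange : ∀ {k} → Shape k → Vec ℕ k → Labeling
arrange s v = Vec.map (lookup v) (ranks s)

raise-arrange : ∀ {k} j (s : Shape k) v → raise j (arrange s v) ≡ arrange s (Vec.map (j +_) v)
raise-arrange j s v =
  trans (sym (Vec.map-∘ (j +_) (lookup v) (ranks s))) (Vec.map-cong (λ i → sym (lookup-map i (j +_) v)) (ranks s))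

levels-from : ∀ {k} → ℕ → Vec ℕ (suc k) → Vec ℕ (suc k)
levels-from v (_ ∷ [])       = v ∷ []
levels-from v (h ∷ h′ ∷ hs) = v ∷ levels-from (suc (v + h)) (h′ ∷ hs)

levels : ∀ {k} → Vec ℕ (suc k) → Vec ℕ (suc k)
levels = levels-from 1

labeling : ∀ {k} → Shape (suc k) → Vec ℕ (suc k) → Labeling
labeling s hs = arrange s (levels hs)

rotate : ∀ {k} → Vec ℕ (suc k) → Vec ℕ (suc k)
rotate (h ∷ hs) = hs ∷ʳ h

levels-from-≥ : ∀ {k} v (hs : Vec ℕ (suc k)) i → v ≤ lookup (levels-from v hs) i
levels-from-≥ v (_ ∷ [])       Fin.zero    = ≤-refl
levels-from-≥ v (h ∷ h′ ∷ hs) Fin.zero    = ≤-refl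
levels-from-≥ v (h ∷ h′ ∷ hs) (Fin.suc i) = ≤-trans (≤-trans (m≤m+n v h) (n≤1+n _)) (levels-from-≥ (suc (v + h)) (h′ ∷ hs) i)

levels-from-< : ∀ {k} v (hs : Vec ℕ (suc k)) {i j} → toℕ i < toℕ j → lookup (levels-from v hs) i < lookup (levels-from v hs) j
levels-from-< v (h ∷ h′ ∷ hs) {Fin.zero}  {Fin.suc j} _          = <-≤-trans (s≤s (m≤m+n v h)) (levels-from-≥ _ (h′ ∷ hs) j)
levels-from-< v (h ∷ h′ ∷ hs) {Fin.suc i} {Fin.suc j} (s≤s i<j) = levels-from-< (suc (v + h)) (h′ ∷ hs) i<j

levels-from-≤ : ∀ {k} v (hs : Vec ℕ (suc k)) i → lookup (levels-from v hs) i ≤ v + k + Vec.sum hs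
levels-from-≤ {k} v hs@(_ ∷ [])      Fin.zero = ≤-trans (m≤m+n v k) (m≤m+n (v + k) (Vec.sum hs))
levels-from-≤ {k} v hs@(_ ∷ _ ∷ _)  Fin.zero = ≤-trans (m≤m+n v k) (m≤m+n (v + k) (Vec.sum hs))
levels-from-≤ {suc k} v (h ∷ h′ ∷ hs) (Fin.suc i) =
  subst (lookup (levels-from (suc (v + h)) (h′ ∷ hs)) i ≤_) (shift-gap v k h (Vec.sum (h′ ∷ hs)))
        (levels-from-≤ (suc (v + h)) (h′ ∷ hs) i)
  where
  shift-gap : ∀ v k h s → suc (v + h) + k + s ≡ v + suc k + (h + s)
  shift-gap = solve-∀

raise-levels-from : ∀ {k} j v (hs : Vec ℕ (suc k)) → Vec.map (j +_) (levels-from v hs) ≡ levels-from (j + v) hs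
raise-levels-from j v (_ ∷ [])       = refl
raise-levels-from j v (h ∷ h′ ∷ hs) =
  cong (j + v ∷_) (trans (raise-levels-from j (suc (v + h)) (h′ ∷ hs)) (cong (λ w → levels-from w (h′ ∷ hs)) (shift j v h)))
  where
  shift : ∀ j v h → j + suc (v + h) ≡ suc (j + v + h)
  shift = solve-∀

levels-from-∷ʳ : ∀ {k} v (hs : Vec ℕ (suc k)) h → levels-from v (hs ∷ʳ h) ≡ levels-from v hs ∷ʳ (v + suc k + Vec.sum hs)
levels-from-∷ʳ v (a ∷ [])      h = cong (λ w → v ∷ w ∷ []) (top v a)
  where
  top : ∀ v a → suc (v + a) ≡ v + 1 + (a + 0)
  top = solve-∀
levels-from-∷ʳ {suc k} v (a ∷ b ∷ hs) h =
  cong (v ∷_) (trans (levels-from-∷ʳ (suc (v + a)) (b ∷ hs) h)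
                     (cong (levels-from (suc (v + a)) (b ∷ hs) ∷ʳ_) (top v k a (Vec.sum (b ∷ hs)))))
  where
  top : ∀ v k a s → suc (v + a) + suc k + s ≡ v + suc (suc k) + (a + s)
  top = solve-∀

arrange-rotation : ∀ {k} (s : Shape (suc (suc k))) h (hs : Vec ℕ (suc k)) →
  arrange s (levels-from (1 + h) hs ∷ʳ (suc (suc k) + Vec.sum (h ∷ hs))) ≡ raise h (labeling s (hs ∷ʳ h))
arrange-rotation {k} s h hs = begin
  arrange s (levels-from (1 + h) hs ∷ʳ (suc (suc k) + Vec.sum (h ∷ hs)))
    ≡⟨ cong₂ (λ v t → arrange s (levels-from v hs ∷ʳ t)) (+-comm 1 h) (top k h (Vec.sum hs)) ⟩
  arrange s (levels-from (h + 1) hs ∷ʳ (h + 1 + suc k + Vec.sum hs))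
    ≡⟨ cong (arrange s) (levels-from-∷ʳ (h + 1) hs h) ⟨
  arrange s (levels-from (h + 1) (hs ∷ʳ h))
    ≡⟨ cong (arrange s) (raise-levels-from h 1 (hs ∷ʳ h)) ⟨
  arrange s (Vec.map (h +_) (levels (hs ∷ʳ h)))
    ≡⟨ raise-arrange h s (levels (hs ∷ʳ h)) ⟨
  raise h (labeling s (hs ∷ʳ h))                                         ∎
  where
  open ≡-Reasoning
  top : ∀ k h s → suc (suc k) + (h + s) ≡ h + 1 + suc k + s
  top = solve-∀

level≤ : ∀ {k q} (hs : Vec ℕ (suc k)) i → q ≡ suc k + Vec.sum hs → lookup (levels hs) i ≤ q
level≤ hs i refl = levels-from-≤ 1 hs i

level< : ∀ {k b d} (hs : Vec ℕ (suc k)) i j → toℕ i < toℕ j →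
         lookup (levels hs) i ≡ 2 + b → lookup (levels hs) j ≡ 2 + d → b < d
level< hs i j i<j eb ed = ≤-pred (≤-pred (subst₂ _<_ eb ed (levels-from-< 1 hs i<j)))

Pro-labeling-levels : ∀ {k q} (s : Shape (suc (suc k))) h (hs : Vec ℕ (suc k)) → q ≡ suc (suc k) + Vec.sum (h ∷ hs) →
  Pro q (labeling s (h ∷ hs)) ≡ arrange (next s) (levels-from (1 + h) hs ∷ʳ q)
Pro-labeling-levels s1324 h hs@(_ ∷ _ ∷ _ ∷ []) q≡ = Pro-one-at-x₁ _ _ _ _ (level≤ (h ∷ hs) (# 2) q≡)
Pro-labeling-levels s2413 h hs@(_ ∷ _ ∷ _ ∷ []) q≡ = Pro-one-at-x₃-d<b _ _ _ _ (level≤ (h ∷ hs) (# 2) q≡)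
  (level< (h ∷ hs) (# 2) (# 3) (s≤s (s≤s (s≤s z≤n))) refl refl)
Pro-labeling-levels s1423 h hs@(_ ∷ _ ∷ _ ∷ []) q≡ = Pro-one-at-x₁ _ _ _ _ (level≤ (h ∷ hs) (# 3) q≡)
Pro-labeling-levels s3412 h hs@(_ ∷ _ ∷ _ ∷ []) q≡ = Pro-one-at-x₃-d<b _ _ _ _ (level≤ (h ∷ hs) (# 1) q≡)
  (level< (h ∷ hs) (# 1) (# 3) (s≤s (s≤s z≤n)) refl refl)
Pro-labeling-levels s2314 h hs@(_ ∷ _ ∷ _ ∷ []) q≡ = Pro-one-at-x₃-b<d _ _ _ _ (level≤ (h ∷ hs) (# 2) q≡)
  (level< (h ∷ hs) (# 2) (# 3) (s≤s (s≤s (s≤s z≤n))) refl refl)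
Pro-labeling-levels s1213 h hs@(_ ∷ _ ∷ []) q≡ = Pro-ones-at-x₁x₃-b<d _ _ _ (level≤ (h ∷ hs) (# 1) q≡)
  (level< (h ∷ hs) (# 1) (# 2) (s≤s (s≤s z≤n)) refl refl)
Pro-labeling-levels s1312 h hs@(_ ∷ _ ∷ []) q≡ = Pro-ones-at-x₁x₃-d<b _ _ _ (level≤ (h ∷ hs) (# 2) q≡)
  (level< (h ∷ hs) (# 1) (# 2) (s≤s (s≤s z≤n)) refl refl)
Pro-labeling-levels s2312 h hs@(_ ∷ _ ∷ []) q≡ = Pro-one-at-x₃-d<b _ _ _ _ (level≤ (h ∷ hs) (# 1) q≡)
  (level< (h ∷ hs) (# 1) (# 2) (s≤s (s≤s z≤n)) refl refl)
Pro-labeling-levels s1323 h hs@(_ ∷ _ ∷ []) q≡ = Pro-one-at-x₁ _ _ _ _ (level≤ (h ∷ hs) (# 2) q≡)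
Pro-labeling-levels s2313 h hs@(_ ∷ _ ∷ []) q≡ = Pro-one-at-x₃-b≡d _ _ _ (level≤ (h ∷ hs) (# 2) q≡)
Pro-labeling-levels s1212 h hs@(_ ∷ []) q≡ = Pro-ones-at-x₁x₃-b≡d _ _ (level≤ (h ∷ hs) (# 1) q≡)

Pro-labeling : ∀ {k q} (s : Shape (suc (suc k))) h (hs : Vec ℕ (suc k)) → q ≡ suc (suc k) + Vec.sum (h ∷ hs) →
  Pro q (labeling s (h ∷ hs)) ≡ raise h (labeling (next s) (hs ∷ʳ h))
Pro-labeling s h hs refl = trans (Pro-labeling-levels s h hs refl) (arrange-rotation (next s) h hs)

sum-rotate : ∀ {k} (hs : Vec ℕ (suc k)) → Vec.sum (rotate hs) ≡ Vec.sum hs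
sum-rotate (h ∷ hs) = sum-∷ʳ hs
  where
  sum-∷ʳ : ∀ {n} (hs : Vec ℕ n) → Vec.sum (hs ∷ʳ h) ≡ h + Vec.sum hs
  sum-∷ʳ []       = refl
  sum-∷ʳ (a ∷ hs) = trans (cong (a +_) (sum-∷ʳ hs)) (x∙yz≈y∙xz a h (Vec.sum hs))

rotate-gaps : ∀ {k q} (hs : Vec ℕ (suc k)) → q ≡ suc k + Vec.sum hs → q ≡ suc k + Vec.sum (rotate hs)
rotate-gaps {k} hs q≡ = trans q≡ (cong (suc k +_) (sym (sum-rotate hs)))

-- One period of an orbit, segment by segment

nexts : ∀ {k} → ℕ → Shape k → Shape k
nexts zero    s = s
nexts (suc n) s = nexts n (next s)

rotations : ∀ {k} → ℕ → Vec ℕ (suc k) → Vec ℕ (suc k)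
rotations zero    hs = hs
rotations (suc n) hs = rotations n (rotate hs)

span : ∀ {k} → ℕ → Vec ℕ (suc k) → ℕ
span zero    hs = 0
span (suc n) hs = suc (head hs) + span n (rotate hs)

labeling-positive : ∀ {k} (s : Shape (suc k)) hs → Positive (labeling s hs)
labeling-positive s hs = VecAll.map⁺ (VecAll.universal (levels-from-≥ 1 hs) (ranks s))

iterate-raise : ∀ q m j e → Positive e → iterate m (Pro q) (raise (m + j) e) ≡ raise j e
iterate-raise q zero    j e _   = refl
iterate-raise q (suc m) j e pos = begin
  Pro q (iterate m (Pro q) (raise (suc m + j) e)) ≡⟨ iterate-suc (Pro q) m (raise (suc m + j) e) ⟨
  iterate m (Pro q) (Pro q (raise (suc m + j) e)) ≡⟨ cong (iterate m (Pro q)) (Pro-raise q (m + j) e pos) ⟩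
  iterate m (Pro q) (raise (m + j) e)             ≡⟨ iterate-raise q m j e pos ⟩
  raise j e                                       ∎
  where open ≡-Reasoning

iterate-segment : ∀ {k q} (s : Shape (suc (suc k))) hs → q ≡ suc (suc k) + Vec.sum hs →
  iterate (suc (head hs)) (Pro q) (labeling s hs) ≡ labeling (next s) (rotate hs)
iterate-segment {q = q} s (h ∷ hs) q≡ = begin
  iterate (suc h) (Pro q) (labeling s (h ∷ hs))  ≡⟨ iterate-suc (Pro q) h _ ⟨
  iterate h (Pro q) (Pro q (labeling s (h ∷ hs))) ≡⟨ cong (iterate h (Pro q)) (Pro-labeling s h hs q≡) ⟩
  iterate h (Pro q) (raise h (labeling (next s) (hs ∷ʳ h)))
    ≡⟨ cong (λ i → iterate h (Pro q) (raise i (labeling (next s) (hs ∷ʳ h)))) (+-identityʳ h) ⟨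
  iterate h (Pro q) (raise (h + 0) (labeling (next s) (hs ∷ʳ h)))
    ≡⟨ iterate-raise q h 0 _ (labeling-positive (next s) (hs ∷ʳ h)) ⟩
  raise 0 (labeling (next s) (hs ∷ʳ h))          ≡⟨ map-id _ ⟩
  labeling (next s) (hs ∷ʳ h)                    ∎
  where open ≡-Reasoning

iterate-segments : ∀ {k q} n (s : Shape (suc (suc k))) hs → q ≡ suc (suc k) + Vec.sum hs →
  iterate (span n hs) (Pro q) (labeling s hs) ≡ labeling (nexts n s) (rotations n hs)
iterate-segments zero    s hs q≡ = refl
iterate-segments {q = q} (suc n) s hs q≡ = begin
  iterate (suc (head hs) + span n (rotate hs)) (Pro q) (labeling s hs)          ≡⟨ iterate-+′ ⟩
  iterate (span n (rotate hs)) (Pro q) (iterate (suc (head hs)) (Pro q) (labeling s hs))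
    ≡⟨ cong (iterate (span n (rotate hs)) (Pro q)) (iterate-segment s hs q≡) ⟩
  iterate (span n (rotate hs)) (Pro q) (labeling (next s) (rotate hs))
    ≡⟨ iterate-segments n (next s) (rotate hs) (rotate-gaps hs q≡) ⟩
  labeling (nexts n (next s)) (rotations n (rotate hs))                        ∎
  where
  open ≡-Reasoning
  iterate-+′ : iterate (suc (head hs) + span n (rotate hs)) (Pro q) (labeling s hs)
               ≡ iterate (span n (rotate hs)) (Pro q) (iterate (suc (head hs)) (Pro q) (labeling s hs))
  iterate-+′ = trans (cong (λ m → iterate m (Pro q) (labeling s hs)) (+-comm (suc (head hs)) _))
                     (iterate-+ (Pro q) (span n (rotate hs)) (suc (head hs)) (labeling s hs))

antipodalSum-raise : ∀ x j e → antipodalSum x (raise j e) ≡ (j + lookup e x) + (j + lookup e (κ x))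
antipodalSum-raise x j e = cong₂ _+_ (lookup-map x (j +_) e) (lookup-map (κ x) (j +_) e)

-- The total antipodal sum of raise h e, raise (h ∸ 1) e, …, e.
segmentSum : Z4 → ℕ → Labeling → ℕ
segmentSum x h e = suc h * antipodalSum x e + h * suc h

sum-segment : ∀ q x h e → Positive e → sum (map (antipodalSum x) (iterates (Pro q) (suc h) (raise h e))) ≡ segmentSum x h e
sum-segment q x zero    e _   = cong (_+ 0) (trans (cong (antipodalSum x) (map-id e)) (sym (+-identityʳ _)))
sum-segment q x (suc h) e pos = begin
  antipodalSum x (raise (suc h) e) + sum (map (antipodalSum x) (iterates (Pro q) (suc h) (Pro q (raise (suc h) e))))
    ≡⟨ cong₂ (λ a f → a + sum (map (antipodalSum x) (iterates (Pro q) (suc h) f))) (antipodalSum-raise x (suc h) e) (Pro-raise q h e pos) ⟩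
  (suc h + lookup e x) + (suc h + lookup e (κ x)) + sum (map (antipodalSum x) (iterates (Pro q) (suc h) (raise h e)))
    ≡⟨ cong ((suc h + lookup e x) + (suc h + lookup e (κ x)) +_) (sum-segment q x h e pos) ⟩
  (suc h + lookup e x) + (suc h + lookup e (κ x)) + segmentSum x h e
    ≡⟨ step h (lookup e x) (lookup e (κ x)) ⟩
  segmentSum x (suc h) e ∎
  where
  open ≡-Reasoning
  step : ∀ h u w → (suc h + u) + (suc h + w) + (suc h * (u + w) + h * suc h) ≡ suc (suc h) * (u + w) + suc h * suc (suc h)
  step = solve-∀

orbitSum : ∀ {k} → Z4 → ℕ → Shape (suc k) → Vec ℕ (suc k) → ℕ
orbitSum x zero    s hs = 0
orbitSum x (suc n) s hs = segmentSum x (head hs) (labeling (next s) (rotate hs)) + orbitSum x n (next s) (rotate hs)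

module _ {k q : ℕ} where

  private
    Shapeₖ Gaps : Set
    Shapeₖ = Shape (suc (suc k))
    Gaps = Vec ℕ (suc (suc k))

  iterates-segments : ∀ n (s : Shapeₖ) hs → q ≡ suc (suc k) + Vec.sum hs →
    iterates (Pro q) (span (suc n) hs) (Pro q (labeling s hs))
      ≡ iterates (Pro q) (suc (head hs)) (raise (head hs) (labeling (next s) (rotate hs)))
        ++ iterates (Pro q) (span n (rotate hs)) (Pro q (labeling (next s) (rotate hs)))
  iterates-segments n s hs@(h ∷ hs′) q≡ = begin
    iterates (Pro q) (suc h + span n (rotate hs)) (Pro q (labeling s hs))
      ≡⟨ iterates-+ (Pro q) (suc h) _ _ ⟩
    iterates (Pro q) (suc h) (Pro q (labeling s hs))
      ++ iterates (Pro q) (span n (rotate hs)) (iterate (suc h) (Pro q) (Pro q (labeling s hs)))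
      ≡⟨ cong₂ (λ f g → iterates (Pro q) (suc h) f ++ iterates (Pro q) (span n (rotate hs)) g)
               (Pro-labeling s h hs′ q≡) (trans (iterate-suc (Pro q) (suc h) _) (cong (Pro q) (iterate-segment s hs q≡))) ⟩
    iterates (Pro q) (suc h) (raise h (labeling (next s) (rotate hs)))
      ++ iterates (Pro q) (span n (rotate hs)) (Pro q (labeling (next s) (rotate hs)))
      ∎
    where open ≡-Reasoning

  sum-segments : ∀ x n (s : Shapeₖ) hs → q ≡ suc (suc k) + Vec.sum hs →
    sum (map (antipodalSum x) (iterates (Pro q) (span n hs) (Pro q (labeling s hs)))) ≡ orbitSum x n s hs
  sum-segments x zero    s hs q≡ = refl
  sum-segments x (suc n) s hs q≡ = begin
    sum (map (antipodalSum x) (iterates (Pro q) (span (suc n) hs) (Pro q (labeling s hs))))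
      ≡⟨ cong (sum ∘ map (antipodalSum x)) (iterates-segments n s hs q≡) ⟩
    sum (map (antipodalSum x) (first ++ rest))
      ≡⟨ cong sum (map-++ (antipodalSum x) first rest) ⟩
    sum (map (antipodalSum x) first ++ map (antipodalSum x) rest)
      ≡⟨ sum-++ (map (antipodalSum x) first) _ ⟩
    sum (map (antipodalSum x) first) + sum (map (antipodalSum x) rest)
      ≡⟨ cong₂ _+_ (sum-segment q x (head hs) _ (labeling-positive (next s) (rotate hs)))
                   (sum-segments x n (next s) (rotate hs) (rotate-gaps hs q≡)) ⟩
    orbitSum x (suc n) s hs ∎
    where
    open ≡-Reasoning
    first rest : List Labeling
    first = iterates (Pro q) (suc (head hs)) (raise (head hs) (labeling (next s) (rotate hs)))
    rest = iterates (Pro q) (span n (rotate hs)) (Pro q (labeling (next s) (rotate hs)))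

  all-segments : ∀ (P : Labeling → Set) (I : Shapeₖ → Gaps → Set) →
    (∀ j e → P e → P (raise j e)) → (∀ {s hs} → I s hs → I (next s) (rotate hs)) → (∀ {s hs} → I s hs → P (labeling s hs)) →
    ∀ n s hs → q ≡ suc (suc k) + Vec.sum hs → I s hs → All P (iterates (Pro q) (span n hs) (Pro q (labeling s hs)))
  all-segments P I P-raise I-next I⇒P zero    s hs q≡ i = []
  all-segments P I P-raise I-next I⇒P (suc n) s hs q≡ i
    rewrite iterates-segments n s hs q≡ =
    All.++⁺ (all-segment (head hs) (labeling-positive (next s) (rotate hs)) (I⇒P (I-next i)))
        (all-segments P I P-raise I-next I⇒P n (next s) (rotate hs) (rotate-gaps hs q≡) (I-next i))
    where
    all-segment : ∀ h {e} → Positive e → P e → All P (iterates (Pro q) (suc h) (raise h e))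
    all-segment zero    {e} pos Pe = subst P (sym (map-id e)) Pe ∷ []
    all-segment (suc h) {e} pos Pe =
      P-raise (suc h) e Pe ∷ subst (All P ∘ iterates (Pro q) (suc h)) (sym (Pro-raise q h e pos)) (all-segment h pos Pe)

-- The pattern 1324 and balancedness

π1324 : List ℕ
π1324 = 1 ∷ 3 ∷ 2 ∷ 4 ∷ []

same-order : ∀ {x y m n} → x < y → m < n → ((x < y) ⇔ (m < n)) × ((y < x) ⇔ (n < m))
same-order x<y m<n =
  mk⇔ (λ _ → m<n) (λ _ → x<y) , mk⇔ (λ y<x → contradiction y<x (<-asym x<y)) (λ n<m → contradiction n<m (<-asym m<n))

same-order⁻¹ : ∀ {x y m n} → y < x → n < m → ((x < y) ⇔ (m < n)) × ((y < x) ⇔ (n < m))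
same-order⁻¹ y<x n<m =
  mk⇔ (λ x<y → contradiction x<y (<-asym y<x)) (λ m<n → contradiction m<n (<-asym n<m)) , mk⇔ (λ _ → n<m) (λ _ → y<x)

Pattern1324 : Labeling → Set
Pattern1324 f = lookup f x₁ < lookup f x₃ × lookup f x₃ < lookup f x₂ × lookup f x₂ < lookup f x₄

contains-1324⇔ : ∀ f → Contains π1324 (word f) ⇔ Pattern1324 f
contains-1324⇔ (a ∷ b ∷ c ∷ d ∷ []) = mk⇔ to from
  where
  to : Contains π1324 (word (a ∷ b ∷ c ∷ d ∷ [])) → a < c × c < b × b < d
  to (_ ∷ _ ∷ _ ∷ _ ∷ [] , sub , ((_ ∷ r13 ∷ _ ∷ []) ∷ (r23 ∷ r24 ∷ []) ∷ _ ∷ [] ∷ []))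
    with toPointwise refl sub
  ... | refl ∷ refl ∷ refl ∷ refl ∷ [] =
    Equivalence.from (proj₁ r13) (s≤s (s≤s z≤n)) , Equivalence.from (proj₂ r23) (s≤s (s≤s (s≤s z≤n))) ,
    Equivalence.from (proj₁ r24) (s≤s (s≤s (s≤s (s≤s z≤n))))
  from : a < c × c < b × b < d → Contains π1324 (word (a ∷ b ∷ c ∷ d ∷ []))
  from (a<c , c<b , b<d) =
    word (a ∷ b ∷ c ∷ d ∷ []) , (refl ∷ refl ∷ refl ∷ refl ∷ []) ,
    ((same-order (<-trans a<c c<b) 1<3 ∷ same-order a<c 1<2 ∷ same-order (<-trans (<-trans a<c c<b) b<d) 1<4 ∷ []) ∷
     (same-order⁻¹ c<b 2<3 ∷ same-order b<d 3<4 ∷ []) ∷ (same-order (<-trans c<b b<d) 2<4 ∷ []) ∷ [] ∷ [])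
    where
    1<2 : 1 < 2
    1<2 = s≤s (s≤s z≤n)
    1<3 : 1 < 3
    1<3 = s≤s (s≤s z≤n)
    1<4 : 1 < 4
    1<4 = s≤s (s≤s z≤n)
    2<3 : 2 < 3
    2<3 = s≤s (s≤s (s≤s z≤n))
    2<4 : 2 < 4
    2<4 = s≤s (s≤s (s≤s z≤n))
    3<4 : 3 < 4
    3<4 = s≤s (s≤s (s≤s (s≤s z≤n)))

avoids-raise : ∀ j f → Avoids π1324 f → Avoids π1324 (raise j f)
avoids-raise j f@(a ∷ b ∷ c ∷ d ∷ []) avoids contains with Equivalence.to (contains-1324⇔ (raise j f)) contains
... | a<c , c<b , b<d =
  avoids (Equivalence.from (contains-1324⇔ f) (+-cancelˡ-< j a c a<c , +-cancelˡ-< j c b c<b , +-cancelˡ-< j b d b<d))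

insert-raise : ∀ j a l → insert (j + a) (map (j +_) l) ≡ map (j +_) (insert a l)
insert-raise j a []      = refl
insert-raise j a (b ∷ l) with a ≤? b
... | yes a≤b rewrite ≤ᵇ-true a≤b | ≤ᵇ-true (+-monoʳ-≤ j a≤b) = refl
... | no  a≰b rewrite ≤ᵇ-false (≰⇒> a≰b) | ≤ᵇ-false (+-monoʳ-< j (≰⇒> a≰b)) = cong (j + b ∷_) (insert-raise j a l)

isort-raise : ∀ j l → isort (map (j +_) l) ≡ map (j +_) (isort l)
isort-raise j []      = refl
isort-raise j (a ∷ l) = trans (cong (insert (j + a)) (isort-raise j l)) (insert-raise j a (isort l))

difference-raise : ∀ j x w → ⁺ (j + x) ℤ.- ⁺ (j + w) ≡ ⁺ x ℤ.- ⁺ w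
difference-raise j x w = trans (ℤP.m-n≡m⊖n (j + x) (j + w)) (trans (ℤP.+-cancelˡ-⊖ j x w) (sym (ℤP.m-n≡m⊖n x w)))

balancedSorted-raise : ∀ q j l → BalancedSorted q l → BalancedSorted q (map (j +_) l)
balancedSorted-raise q j (w ∷ x ∷ y ∷ z ∷ []) (inj₁ eq) =
  inj₁ (trans (difference-raise j x w) (trans eq (sym (difference-raise j z y))))
balancedSorted-raise q j (w ∷ x ∷ y ∷ z ∷ []) (inj₂ eq) =
  inj₂ (trans (cong (ℤ._+ ⁺ q) (difference-raise j w z)) (trans eq (sym (difference-raise j y x))))

balanced-raise : ∀ q j f → Balanced q f → Balanced q (raise j f)
balanced-raise q j f@(_ ∷ _ ∷ _ ∷ _ ∷ []) balanced =
  subst (BalancedSorted q) (sym (isort-raise j (word f))) (balancedSorted-raise q j (isort (word f)) balanced)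

difference : ∀ {x} w t → x ≡ w + t → ⁺ x ℤ.- ⁺ w ≡ ⁺ t
difference w t refl =
  trans (ℤP.m-n≡m⊖n (w + t) w) (trans (ℤP.⊖-≥ (m≤m+n w t)) (cong ⁺_ (m+n∸m≡n w t)))

wrap-difference : ∀ {q} w z t → q ≡ z + t → ⁺ w ℤ.- ⁺ z ℤ.+ ⁺ q ≡ ⁺ (w + t)
wrap-difference w z t refl =
  trans (cong (λ u → ⁺ w ℤ.- ⁺ z ℤ.+ u) (ℤP.pos-+ z t)) (trans (cancel (⁺ w) (⁺ z) (⁺ t)) (sym (ℤP.pos-+ w t)))
  where
  cancel : ∀ (w z t : ℤ) → w ℤ.- z ℤ.+ (z ℤ.+ t) ≡ w ℤ.+ t
  cancel = ℤSolver.solve-∀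

OppositeGapsAgree : Vec ℕ 4 → Set
OppositeGapsAgree (a ∷ b ∷ c ∷ d ∷ []) = a ≡ c ⊎ b ≡ d

balancedSorted-levels⇔ : ∀ {q} a b c d → q ≡ 4 + Vec.sum (a ∷ b ∷ c ∷ d ∷ []) →
  BalancedSorted q (1 ∷ 2 + a ∷ 3 + a + b ∷ 4 + a + b + c ∷ []) ⇔ OppositeGapsAgree (a ∷ b ∷ c ∷ d ∷ [])
balancedSorted-levels⇔ {q} a b c d q≡ = mk⇔ to from
  where
  x-w : ⁺ (2 + a) ℤ.- ⁺ 1 ≡ ⁺ (1 + a)
  x-w = difference 1 (1 + a) refl
  y-x : ⁺ (3 + a + b) ℤ.- ⁺ (2 + a) ≡ ⁺ (1 + b)
  y-x = difference (2 + a) (1 + b) (cong suc (cong suc (sym (+-suc a b))))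
  z-y : ⁺ (4 + a + b + c) ℤ.- ⁺ (3 + a + b) ≡ ⁺ (1 + c)
  z-y = difference (3 + a + b) (1 + c) (cong (suc ∘ suc ∘ suc) (sym (+-suc (a + b) c)))
  w-z+q : ⁺ 1 ℤ.- ⁺ (4 + a + b + c) ℤ.+ ⁺ q ≡ ⁺ (1 + d)
  w-z+q = wrap-difference 1 (4 + a + b + c) d (trans q≡ (top a b c d))
    where
    top : ∀ a b c d → 4 + (a + (b + (c + (d + 0)))) ≡ 4 + a + b + c + d
    top = solve-∀
  ⁺-injective : ∀ {m n} → ⁺ (1 + m) ≡ ⁺ (1 + n) → m ≡ n
  ⁺-injective = suc-injective ∘ ℤP.+-injective
  to : BalancedSorted q (1 ∷ 2 + a ∷ 3 + a + b ∷ 4 + a + b + c ∷ []) → a ≡ c ⊎ b ≡ d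
  to (inj₁ eq) = inj₁ (⁺-injective (trans (sym x-w) (trans eq z-y)))
  to (inj₂ eq) = inj₂ (sym (⁺-injective (trans (sym w-z+q) (trans eq y-x))))
  from : a ≡ c ⊎ b ≡ d → BalancedSorted q (1 ∷ 2 + a ∷ 3 + a + b ∷ 4 + a + b + c ∷ [])
  from (inj₁ refl) = inj₁ (trans x-w (sym z-y))
  from (inj₂ refl) = inj₂ (trans w-z+q (sym y-x))

isort-1324 : ∀ {w x y z} → w < x → x < y → y < z → isort (w ∷ y ∷ x ∷ z ∷ []) ≡ w ∷ x ∷ y ∷ z ∷ []
isort-1324 w<x x<y y<z
  rewrite ≤ᵇ-true (<⇒≤ (<-trans x<y y<z)) | ≤ᵇ-false x<y | ≤ᵇ-true (<⇒≤ y<z) | ≤ᵇ-true (<⇒≤ w<x) = refl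

isort-2413 : ∀ {w x y z} → w < x → x < y → y < z → isort (x ∷ z ∷ w ∷ y ∷ []) ≡ w ∷ x ∷ y ∷ z ∷ []
isort-2413 w<x x<y y<z
  rewrite ≤ᵇ-true (<⇒≤ (<-trans w<x x<y)) | ≤ᵇ-false (<-trans (<-trans w<x x<y) y<z) | ≤ᵇ-false y<z
        | ≤ᵇ-false w<x | ≤ᵇ-true (<⇒≤ x<y) = refl

-- The four orbit families

HasMean : ℕ → (Labeling → ℕ) → List Labeling → Set
HasMean m η L = sum (map η L) ≡ m * length L

Dichotomy : ℕ → List Labeling → Set
Dichotomy q L =
    ((∀ x → HasMean (suc q) (antipodalSum x) L) × All (Avoids π1324) L)
  ⊎ ((∀ x → HasMean (suc q) (antipodalSum x) L ⇔ All (Balanced q) L) × ¬ All (Avoids π1324) L)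

hasMean-↭ : ∀ m η {L L′} → L ↭ L′ → HasMean m η L → HasMean m η L′
hasMean-↭ m η L↭L′ mean = trans (sym (sum-↭ (map⁺ η L↭L′))) (trans mean (cong (m *_) (↭-length L↭L′)))

dichotomy-↭ : ∀ {q L L′} → L ↭ L′ → Dichotomy q L → Dichotomy q L′
dichotomy-↭ {q} L↭L′ (inj₁ (means , avoid)) =
  inj₁ ((λ x → hasMean-↭ (suc q) (antipodalSum x) L↭L′ (means x)) , All-resp-↭ L↭L′ avoid)
dichotomy-↭ {q} L↭L′ (inj₂ (means⇔ , ¬avoid)) =
  inj₂ ((λ x → mk⇔ (λ mean → All-resp-↭ L↭L′ (Equivalence.to (means⇔ x) (mean-↭ x (↭-sym L↭L′) mean)))
                    (λ bal → mean-↭ x L↭L′ (Equivalence.from (means⇔ x) (All-resp-↭ (↭-sym L↭L′) bal))))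
       , ¬avoid ∘ All-resp-↭ (↭-sym L↭L′))
  where
  mean-↭ : ∀ x {L L′} → L ↭ L′ → HasMean (suc q) (antipodalSum x) L → HasMean (suc q) (antipodalSum x) L′
  mean-↭ x = hasMean-↭ (suc q) (antipodalSum x)

record OrbitDichotomy (q : ℕ) (f : Labeling) : Set where
  field
    period   : ℕ
    0<period : 0 < period
    periodic : iterate period (Pro q) f ≡ f
    dichotomy  : Dichotomy q (iterates (Pro q) period f)

dichotomy-iterate : ∀ {q f} → OrbitDichotomy q f → ∀ t → OrbitDichotomy q (iterate t (Pro q) f)
dichotomy-iterate {q} v t = record
  { period   = period
  ; 0<period = 0<period
  ; periodic = iterate-periodic (Pro q) {period} periodic t
  ; dichotomy  = dichotomy-↭ (↭-sym (iterates-shift (Pro q) periodic t)) dichotomy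
  }
  where open OrbitDichotomy v

antipodalSum-κ : ∀ x e → antipodalSum (κ x) e ≡ antipodalSum x e
antipodalSum-κ x₁ e = +-comm (lookup e x₄) (lookup e x₁)
antipodalSum-κ x₂ e = +-comm (lookup e x₃) (lookup e x₂)
antipodalSum-κ x₃ e = +-comm (lookup e x₂) (lookup e x₃)
antipodalSum-κ x₄ e = +-comm (lookup e x₁) (lookup e x₄)

for-every-x : ∀ {P : Z4 → Set} → P x₁ → P x₂ → (∀ x → P x → P (κ x)) → ∀ x → P x
for-every-x p₁ p₂ p-κ x₁ = p₁
for-every-x p₁ p₂ p-κ x₂ = p₂
for-every-x p₁ p₂ p-κ x₃ = p-κ x₂ p₂
for-every-x p₁ p₂ p-κ x₄ = p-κ x₁ p₁

-- Labelings of shape 2413 avoid 1324 as well, but they share their orbits with shape 1324.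
Avoiding : ∀ {k} → Shape k → Set
Avoiding s1324 = ⊥
Avoiding s2413 = ⊥
Avoiding _     = ⊤

next-avoiding : ∀ {k} (s : Shape k) → Avoiding s → Avoiding (next s)
next-avoiding s1423 _ = _
next-avoiding s3412 _ = _
next-avoiding s2314 _ = _
next-avoiding s1213 _ = _
next-avoiding s1312 _ = _
next-avoiding s2312 _ = _
next-avoiding s1323 _ = _
next-avoiding s2313 _ = _
next-avoiding s1212 _ = _

avoiding-avoids : ∀ {k} (s : Shape (suc k)) hs → Avoiding s → Avoids π1324 (labeling s hs)
avoiding-avoids s hs avoiding contains = shape-avoids s hs avoiding (Equivalence.to (contains-1324⇔ (labeling s hs)) contains)
  where
  shape-avoids : ∀ {k} (s : Shape (suc k)) hs → Avoiding s → ¬ Pattern1324 (labeling s hs)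
  shape-avoids s1423 hs@(_ ∷ _ ∷ _ ∷ _ ∷ []) _ (_ , _ , z<y) = <-asym z<y (levels-from-< 1 hs {# 2} {# 3} (s≤s (s≤s (s≤s z≤n))))
  shape-avoids s3412 (_ ∷ _ ∷ _ ∷ _ ∷ []) _ (s≤s () , _)
  shape-avoids s2314 (_ ∷ _ ∷ _ ∷ _ ∷ []) _ (s≤s () , _)
  shape-avoids s1213 (_ ∷ _ ∷ _ ∷ []) _ (s≤s () , _)
  shape-avoids s1312 (_ ∷ _ ∷ _ ∷ []) _ (s≤s () , _)
  shape-avoids s2312 (_ ∷ _ ∷ _ ∷ []) _ (s≤s () , _)
  shape-avoids s1323 (_ ∷ _ ∷ _ ∷ []) _ (_ , _ , y<y) = <-irrefl refl y<y
  shape-avoids s2313 (_ ∷ _ ∷ _ ∷ []) _ (s≤s () , _)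
  shape-avoids s1212 (_ ∷ _ ∷ []) _ (s≤s () , _)

orbitSum-κ : ∀ {k} x n (s : Shape (suc k)) hs → orbitSum (κ x) n s hs ≡ orbitSum x n s hs
orbitSum-κ x zero    s hs = refl
orbitSum-κ x (suc n) s hs =
  cong₂ (λ a r → suc (Vec.head hs) * a + Vec.head hs * suc (Vec.head hs) + r)
        (antipodalSum-κ x (labeling (next s) (rotate hs))) (orbitSum-κ x n (next s) (rotate hs))

module OrbitOf {k q : ℕ} (s : Shape (suc (suc k))) (hs : Vec ℕ (suc (suc k))) (n : ℕ)
               (q≡ : q ≡ suc (suc k) + Vec.sum hs) (returns : labeling (nexts n s) (rotations n hs) ≡ labeling s hs) where

  e : Labeling
  e = labeling s hs
  p : ℕ
  p = span n hs
  L : List Labeling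
  L = iterates (Pro q) p e

  periodic : iterate p (Pro q) e ≡ e
  periodic = trans (iterate-segments n s hs q≡) returns

  from-next↭ : iterates (Pro q) p (Pro q e) ↭ L
  from-next↭ = iterates-rotate (Pro q) periodic

  mean⇔orbitSum : ∀ x → HasMean (suc q) (antipodalSum x) L ⇔ (orbitSum x n s hs ≡ suc q * p)
  mean⇔orbitSum x = mk⇔
    (λ mean → trans (sym (sum-segments x n s hs q≡))
                    (trans (hasMean-↭ (suc q) (antipodalSum x) (↭-sym from-next↭) mean) (cong (suc q *_) (length-iterates (Pro q) p _))))
    (λ sum≡ → hasMean-↭ (suc q) (antipodalSum x) from-next↭
                (trans (sum-segments x n s hs q≡) (trans sum≡ (cong (suc q *_) (sym (length-iterates (Pro q) p _))))))

  all-along : ∀ (P : Labeling → Set) (I : Shape (suc (suc k)) → Vec ℕ (suc (suc k)) → Set) →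
    (∀ j e → P e → P (raise j e)) → (∀ {s hs} → I s hs → I (next s) (rotate hs)) → (∀ {s hs} → I s hs → P (labeling s hs)) →
    I s hs → All P L
  all-along P I P-raise I-next I⇒P i = All-resp-↭ from-next↭ (all-segments P I P-raise I-next I⇒P n s hs q≡ i)

  avoiding-dichotomy : 0 < p → Avoiding s → (∀ x → orbitSum x n s hs ≡ suc q * p) → OrbitDichotomy q e
  avoiding-dichotomy 0<p avoiding sums = record
    { period = p ; 0<period = 0<p ; periodic = periodic
    ; dichotomy = inj₁ ((λ x → Equivalence.from (mean⇔orbitSum x) (sums x))
                     , all-along (Avoids π1324) (λ s _ → Avoiding s) avoids-raise (next-avoiding _)
                                 (λ {s} {hs} → avoiding-avoids s hs) avoiding) }

-- Each xᵢ-sum below is `orbitSum xᵢ n s hs ≡ suc q * span n hs` with both sides unfolded,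
-- as the ring solver only sees through _+_ and _*_.
dichotomy-1212 : ∀ {q} hs → q ≡ 2 + Vec.sum hs → OrbitDichotomy q (labeling s1212 hs)
dichotomy-1212 hs@(a ∷ b ∷ []) refl =
  avoiding-dichotomy (s≤s z≤n) _ (for-every-x (x₁-sum a b) (x₂-sum a b) (λ x → trans (orbitSum-κ x 2 s1212 hs)))
  where
  open OrbitOf s1212 hs 2 refl refl
  x₁-sum : ∀ a b →
      suc a * (1 + (2 + b)) + a * suc a +
      (suc b * (1 + (2 + a)) + b * suc b + 0)
    ≡ suc (2 + (a + (b + 0))) * (suc a + (suc b + 0))
  x₁-sum = solve-∀
  x₂-sum : ∀ a b →
      suc a * ((2 + b) + 1) + a * suc a +
      (suc b * ((2 + a) + 1) + b * suc b + 0)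
    ≡ suc (2 + (a + (b + 0))) * (suc a + (suc b + 0))
  x₂-sum = solve-∀

dichotomy-1423 : ∀ {q} hs → q ≡ 4 + Vec.sum hs → OrbitDichotomy q (labeling s1423 hs)
dichotomy-1423 hs@(a ∷ b ∷ c ∷ d ∷ []) refl =
  avoiding-dichotomy (s≤s z≤n) _ (for-every-x (x₁-sum a b c d) (x₂-sum a b c d) (λ x → trans (orbitSum-κ x 12 s1423 hs)))
  where
  open OrbitOf s1423 hs 12 refl refl
  x₁-sum : ∀ a b c d →
      suc a * ((3 + b + c) + (2 + b)) + a * suc a +
      (suc b * ((2 + c) + (4 + c + d + a)) + b * suc b +
      (suc c * (1 + (3 + d + a)) + c * suc c +
      (suc d * ((3 + a + b) + (2 + a)) + d * suc d +
      (suc a * ((2 + b) + (4 + b + c + d)) + a * suc a +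
      (suc b * (1 + (3 + c + d)) + b * suc b +
      (suc c * ((3 + d + a) + (2 + d)) + c * suc c +
      (suc d * ((2 + a) + (4 + a + b + c)) + d * suc d +
      (suc a * (1 + (3 + b + c)) + a * suc a +
      (suc b * ((3 + c + d) + (2 + c)) + b * suc b +
      (suc c * ((2 + d) + (4 + d + a + b)) + c * suc c +
      (suc d * (1 + (3 + a + b)) + d * suc d + 0)))))))))))
    ≡ suc (4 + (a + (b + (c + (d + 0))))) *
        (suc a + (suc b + (suc c + (suc d + (suc a + (suc b + (suc c + (suc d + (suc a + (suc b +
        (suc c + (suc d + 0))))))))))))
  x₁-sum = solve-∀
  x₂-sum : ∀ a b c d →
      suc a * ((4 + b + c + d) + 1) + a * suc a +
      (suc b * ((3 + c + d) + 1) + b * suc b +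
      (suc c * ((4 + d + a + b) + (2 + d)) + c * suc c +
      (suc d * ((4 + a + b + c) + 1) + d * suc d +
      (suc a * ((3 + b + c) + 1) + a * suc a +
      (suc b * ((4 + c + d + a) + (2 + c)) + b * suc b +
      (suc c * ((4 + d + a + b) + 1) + c * suc c +
      (suc d * ((3 + a + b) + 1) + d * suc d +
      (suc a * ((4 + b + c + d) + (2 + b)) + a * suc a +
      (suc b * ((4 + c + d + a) + 1) + b * suc b +
      (suc c * ((3 + d + a) + 1) + c * suc c +
      (suc d * ((4 + a + b + c) + (2 + a)) + d * suc d + 0)))))))))))
    ≡ suc (4 + (a + (b + (c + (d + 0))))) *
        (suc a + (suc b + (suc c + (suc d + (suc a + (suc b + (suc c + (suc d + (suc a + (suc b +
        (suc c + (suc d + 0))))))))))))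
  x₂-sum = solve-∀

dichotomy-1213 : ∀ {q} hs → q ≡ 3 + Vec.sum hs → OrbitDichotomy q (labeling s1213 hs)
dichotomy-1213 hs@(a ∷ b ∷ c ∷ []) refl =
  avoiding-dichotomy (s≤s z≤n) _ (for-every-x (x₁-sum a b c) (x₂-sum a b c) (λ x → trans (orbitSum-κ x 15 s1213 hs)))
  where
  open OrbitOf s1213 hs 15 refl refl
  x₁-sum : ∀ a b c →
      suc a * (1 + (2 + b)) + a * suc a +
      (suc b * ((2 + c) + (3 + c + a)) + b * suc b +
      (suc c * (1 + (3 + a + b)) + c * suc c +
      (suc a * ((2 + b) + (2 + b)) + a * suc a +
      (suc b * (1 + (3 + c + a)) + b * suc b +
      (suc c * (1 + (2 + a)) + c * suc c +
      (suc a * ((2 + b) + (3 + b + c)) + a * suc a +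
      (suc b * (1 + (3 + c + a)) + b * suc b +
      (suc c * ((2 + a) + (2 + a)) + c * suc c +
      (suc a * (1 + (3 + b + c)) + a * suc a +
      (suc b * (1 + (2 + c)) + b * suc b +
      (suc c * ((2 + a) + (3 + a + b)) + c * suc c +
      (suc a * (1 + (3 + b + c)) + a * suc a +
      (suc b * ((2 + c) + (2 + c)) + b * suc b +
      (suc c * (1 + (3 + a + b)) + c * suc c + 0))))))))))))))
    ≡ suc (3 + (a + (b + (c + 0)))) *
        (suc a + (suc b + (suc c + (suc a + (suc b + (suc c + (suc a + (suc b + (suc c + (suc a +
        (suc b + (suc c + (suc a + (suc b + (suc c + 0)))))))))))))))
  x₁-sum = solve-∀
  x₂-sum : ∀ a b c →
      suc a * ((3 + b + c) + 1) + a * suc a +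
      (suc b * ((3 + c + a) + 1) + b * suc b +
      (suc c * ((3 + a + b) + (2 + a)) + c * suc c +
      (suc a * ((3 + b + c) + 1) + a * suc a +
      (suc b * ((2 + c) + 1) + b * suc b +
      (suc c * ((3 + a + b) + 1) + c * suc c +
      (suc a * ((3 + b + c) + 1) + a * suc a +
      (suc b * ((3 + c + a) + (2 + c)) + b * suc b +
      (suc c * ((3 + a + b) + 1) + c * suc c +
      (suc a * ((2 + b) + 1) + a * suc a +
      (suc b * ((3 + c + a) + 1) + b * suc b +
      (suc c * ((3 + a + b) + 1) + c * suc c +
      (suc a * ((3 + b + c) + (2 + b)) + a * suc a +
      (suc b * ((3 + c + a) + 1) + b * suc b +
      (suc c * ((2 + a) + 1) + c * suc c + 0))))))))))))))
    ≡ suc (3 + (a + (b + (c + 0)))) *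
        (suc a + (suc b + (suc c + (suc a + (suc b + (suc c + (suc a + (suc b + (suc c + (suc a +
        (suc b + (suc c + (suc a + (suc b + (suc c + 0)))))))))))))))
  x₂-sum = solve-∀

cross-products⇔ : ∀ a b c d → (a * d + b * c ≡ a * b + c * d) ⇔ (a ≡ c ⊎ b ≡ d)
cross-products⇔ a b c d = mk⇔ to from
  where
  to : a * d + b * c ≡ a * b + c * d → a ≡ c ⊎ b ≡ d
  to eq with <-cmp b d
  ... | tri≈ _ b≡d _ = inj₂ b≡d
  ... | tri< b<d _ _ with m≤n⇒∃[o]m+o≡n b<d
  ...   | t , refl = inj₁ (*-cancelʳ-≡ a c (suc t) (+-cancelˡ-≡ (a * b + b * c) _ _ (trans (left a b c t) (trans eq (right a b c t)))))
    where
    left : ∀ a b c t → a * b + b * c + a * suc t ≡ a * (suc b + t) + b * c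
    left = solve-∀
    right : ∀ a b c t → a * b + c * (suc b + t) ≡ a * b + b * c + c * suc t
    right = solve-∀
  to eq | tri> _ _ d<b with m≤n⇒∃[o]m+o≡n d<b
  ...   | t , refl = inj₁ (sym (*-cancelʳ-≡ c a (suc t) (+-cancelˡ-≡ (a * d + c * d) _ _ (trans (left a d c t) (trans eq (right a d c t))))))
    where
    left : ∀ a d c t → a * d + c * d + c * suc t ≡ a * d + (suc d + t) * c
    left = solve-∀
    right : ∀ a d c t → a * (suc d + t) + c * d ≡ a * d + c * d + a * suc t
    right = solve-∀
  from : a ≡ c ⊎ b ≡ d → a * d + b * c ≡ a * b + c * d
  from (inj₁ refl) = rearrange a b d
    where
    rearrange : ∀ a b d → a * d + b * a ≡ a * b + a * d
    rearrange = solve-∀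
  from (inj₂ refl) = cong (a * b +_) (*-comm b c)

offset⇔ : ∀ {s t u v : ℕ} → s + u ≡ t + v → (s ≡ t) ⇔ (u ≡ v)
offset⇔ {s} {t} {u} {v} eq =
  mk⇔ (λ s≡t → +-cancelˡ-≡ t u v (trans (cong (_+ u) (sym s≡t)) eq))
      (λ u≡v → +-cancelʳ-≡ u s t (trans eq (cong (t +_) (sym u≡v))))

levels₄-increasing : ∀ (hs : Vec ℕ 4) → let v = levels hs in
  lookup v (# 0) < lookup v (# 1) × lookup v (# 1) < lookup v (# 2) × lookup v (# 2) < lookup v (# 3)
levels₄-increasing hs =
  levels-from-< 1 hs (s≤s z≤n) , levels-from-< 1 hs (s≤s (s≤s z≤n)) , levels-from-< 1 hs (s≤s (s≤s (s≤s z≤n)))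

balanced-1324⇔ : ∀ {q} hs → q ≡ 4 + Vec.sum hs → Balanced q (labeling s1324 hs) ⇔ OppositeGapsAgree hs
balanced-1324⇔ {q} hs@(a ∷ b ∷ c ∷ d ∷ []) q≡ with levels₄-increasing hs
... | w<x , x<y , y<z =
  subst (λ l → BalancedSorted q l ⇔ OppositeGapsAgree hs) (sym (isort-1324 {1} {2 + a} {3 + a + b} {4 + a + b + c} w<x x<y y<z))
        (balancedSorted-levels⇔ a b c d q≡)

balanced-2413⇔ : ∀ {q} hs → q ≡ 4 + Vec.sum hs → Balanced q (labeling s2413 hs) ⇔ OppositeGapsAgree hs
balanced-2413⇔ {q} hs@(a ∷ b ∷ c ∷ d ∷ []) q≡ with levels₄-increasing hs
... | w<x , x<y , y<z =
  subst (λ l → BalancedSorted q l ⇔ OppositeGapsAgree hs) (sym (isort-2413 {1} {2 + a} {3 + a + b} {4 + a + b + c} w<x x<y y<z))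
        (balancedSorted-levels⇔ a b c d q≡)

data Family1324 : Shape 4 → Set where
  s1324∈ : Family1324 s1324
  s2413∈ : Family1324 s2413

BalancedOrbitInvariant : ℕ → Shape 4 → Vec ℕ 4 → Set
BalancedOrbitInvariant q s hs = Family1324 s × q ≡ 4 + Vec.sum hs × OppositeGapsAgree hs

balancedOrbitInvariant-next : ∀ {q s hs} → BalancedOrbitInvariant q s hs → BalancedOrbitInvariant q (next s) (rotate hs)
balancedOrbitInvariant-next {hs = hs@(_ ∷ _ ∷ _ ∷ _ ∷ [])} (member , q≡ , agree) =
  next-member member , rotate-gaps hs q≡ , rotate-agree agree
  where
  next-member : ∀ {s} → Family1324 s → Family1324 (next s)
  next-member s1324∈ = s2413∈
  next-member s2413∈ = s1324∈
  rotate-agree : ∀ {a b c d} → a ≡ c ⊎ b ≡ d → b ≡ d ⊎ c ≡ a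
  rotate-agree (inj₁ a≡c) = inj₂ (sym a≡c)
  rotate-agree (inj₂ b≡d) = inj₁ b≡d

balancedOrbitInvariant-balanced : ∀ {q s hs} → BalancedOrbitInvariant q s hs → Balanced q (labeling s hs)
balancedOrbitInvariant-balanced {hs = hs} (s1324∈ , q≡ , agree) = Equivalence.from (balanced-1324⇔ hs q≡) agree
balancedOrbitInvariant-balanced {hs = hs} (s2413∈ , q≡ , agree) = Equivalence.from (balanced-2413⇔ hs q≡) agree

dichotomy-1324 : ∀ {q} hs → q ≡ 4 + Vec.sum hs → OrbitDichotomy q (labeling s1324 hs)
dichotomy-1324 {q} hs@(a ∷ b ∷ c ∷ d ∷ []) refl = record
  { period = p ; 0<period = s≤s z≤n ; periodic = periodic
  ; dichotomy = inj₂ (for-every-x {P = λ x → HasMean (suc q) (antipodalSum x) L ⇔ All (Balanced q) L} mean₁⇔ mean₂⇔ mean-κ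
                     , contains) }
  where
  open OrbitOf s1324 hs 4 refl refl
  -- The orbit sums deviate from the mean by ±(a − c)(b − d), in opposite directions for x₁ and x₂.
  x₁-sum : ∀ a b c d →
      (suc a * ((2 + b) + (3 + b + c)) + a * suc a +
      (suc b * (1 + (4 + c + d + a)) + b * suc b +
      (suc c * ((2 + d) + (3 + d + a)) + c * suc c +
      (suc d * (1 + (4 + a + b + c)) + d * suc d + 0)))) + (a * d + b * c)
    ≡ suc (4 + (a + (b + (c + (d + 0))))) * (suc a + (suc b + (suc c + (suc d + 0)))) + (a * b + c * d)
  x₁-sum = solve-∀
  x₂-sum : ∀ a b c d →
      (suc a * ((4 + b + c + d) + 1) + a * suc a +
      (suc b * ((3 + c + d) + (2 + c)) + b * suc b +
      (suc c * ((4 + d + a + b) + 1) + c * suc c +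
      (suc d * ((3 + a + b) + (2 + a)) + d * suc d + 0)))) + (a * b + c * d)
    ≡ suc (4 + (a + (b + (c + (d + 0))))) * (suc a + (suc b + (suc c + (suc d + 0)))) + (a * d + b * c)
  x₂-sum = solve-∀
  balanced⇔ : All (Balanced q) L ⇔ OppositeGapsAgree hs
  balanced⇔ = mk⇔ (λ { (balanced ∷ _) → Equivalence.to (balanced-1324⇔ hs refl) balanced })
                  (λ agree → all-along (Balanced q) (BalancedOrbitInvariant q) (balanced-raise q) balancedOrbitInvariant-next
                                       balancedOrbitInvariant-balanced (s1324∈ , refl , agree))
  mean₁⇔ : HasMean (suc q) (antipodalSum x₁) L ⇔ All (Balanced q) L
  mean₁⇔ = ⇔-trans (mean⇔orbitSum x₁) (⇔-trans (offset⇔ (x₁-sum a b c d))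
             (⇔-trans (cross-products⇔ a b c d) (⇔-sym balanced⇔)))
  mean₂⇔ : HasMean (suc q) (antipodalSum x₂) L ⇔ All (Balanced q) L
  mean₂⇔ = ⇔-trans (mean⇔orbitSum x₂) (⇔-trans (offset⇔ (x₂-sum a b c d))
             (⇔-trans (mk⇔ sym sym) (⇔-trans (cross-products⇔ a b c d) (⇔-sym balanced⇔))))
  mean-κ : ∀ x → HasMean (suc q) (antipodalSum x) L ⇔ All (Balanced q) L →
                 HasMean (suc q) (antipodalSum (κ x)) L ⇔ All (Balanced q) L
  mean-κ x = subst (_⇔ All (Balanced q) L) (cong (λ n → n ≡ suc q * length L) (cong sum (sym (map-cong (antipodalSum-κ x) L))))
  contains : ¬ All (Avoids π1324) L
  contains (avoids ∷ _) = avoids (Equivalence.from (contains-1324⇔ e) (levels₄-increasing hs))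

-- Every increasing labeling lies on one of these orbits

sum-rotations : ∀ {k} n (hs : Vec ℕ (suc k)) → Vec.sum (rotations n hs) ≡ Vec.sum hs
sum-rotations zero    hs = refl
sum-rotations (suc n) hs = trans (sum-rotations n (rotate hs)) (sum-rotate hs)

dichotomy-along : ∀ {k q} n (s : Shape (suc (suc k))) hs → q ≡ suc (suc k) + Vec.sum (rotations n hs) →
  (q ≡ suc (suc k) + Vec.sum hs → OrbitDichotomy q (labeling s hs)) → OrbitDichotomy q (labeling (nexts n s) (rotations n hs))
dichotomy-along {k} {q} n s hs q≡ start =
  subst (OrbitDichotomy q) (iterate-segments n s hs q≡′) (dichotomy-iterate (start q≡′) (span n hs))
  where
  q≡′ : q ≡ suc (suc k) + Vec.sum hs
  q≡′ = trans q≡ (cong (suc (suc k) +_) (sum-rotations n hs))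

labeling-dichotomy : ∀ {k q} (s : Shape (suc (suc k))) hs → q ≡ suc (suc k) + Vec.sum hs → OrbitDichotomy q (labeling s hs)
labeling-dichotomy s1324 hs                  = dichotomy-1324 hs
labeling-dichotomy s2413 (a ∷ b ∷ c ∷ d ∷ []) = λ q≡ → dichotomy-along 1 s1324 (d ∷ a ∷ b ∷ c ∷ []) q≡
    (dichotomy-1324 (d ∷ a ∷ b ∷ c ∷ []))
labeling-dichotomy s1423 hs                  = dichotomy-1423 hs
labeling-dichotomy s3412 (a ∷ b ∷ c ∷ d ∷ []) = λ q≡ → dichotomy-along 1 s1423 (d ∷ a ∷ b ∷ c ∷ []) q≡
    (dichotomy-1423 (d ∷ a ∷ b ∷ c ∷ []))
labeling-dichotomy s2314 (a ∷ b ∷ c ∷ d ∷ []) = λ q≡ → dichotomy-along 2 s1423 (c ∷ d ∷ a ∷ b ∷ []) q≡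
    (dichotomy-1423 (c ∷ d ∷ a ∷ b ∷ []))
labeling-dichotomy s1213 hs                  = dichotomy-1213 hs
labeling-dichotomy s1312 (a ∷ b ∷ c ∷ [])     = λ q≡ → dichotomy-along 1 s1213 (c ∷ a ∷ b ∷ []) q≡
    (dichotomy-1213 (c ∷ a ∷ b ∷ []))
labeling-dichotomy s2313 (a ∷ b ∷ c ∷ [])     = λ q≡ → dichotomy-along 2 s1213 (b ∷ c ∷ a ∷ []) q≡
    (dichotomy-1213 (b ∷ c ∷ a ∷ []))
labeling-dichotomy s1323 (a ∷ b ∷ c ∷ [])     = λ q≡ → dichotomy-along 3 s1213 (a ∷ b ∷ c ∷ []) q≡
    (dichotomy-1213 (a ∷ b ∷ c ∷ []))
labeling-dichotomy s2312 (a ∷ b ∷ c ∷ [])     = λ q≡ → dichotomy-along 4 s1213 (c ∷ a ∷ b ∷ []) q≡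
    (dichotomy-1213 (c ∷ a ∷ b ∷ []))
labeling-dichotomy s1212 hs                  = dichotomy-1212 hs

reach-from-previous : ∀ {k q} (s : Shape (suc (suc k))) j m (gs : Vec ℕ (suc k)) → q ≡ suc (suc k) + Vec.sum (m + j ∷ gs) →
  iterate (suc m) (Pro q) (labeling s (m + j ∷ gs)) ≡ arrange (next s) (levels-from (suc j) (gs ∷ʳ (m + j)))
reach-from-previous {q = q} s j m gs q≡ = begin
  iterate (suc m) (Pro q) (labeling s (m + j ∷ gs))
    ≡⟨ iterate-suc (Pro q) m (labeling s (m + j ∷ gs)) ⟨
  iterate m (Pro q) (Pro q (labeling s (m + j ∷ gs)))
    ≡⟨ cong (iterate m (Pro q)) (Pro-labeling s (m + j) gs q≡) ⟩
  iterate m (Pro q) (raise (m + j) (labeling (next s) (gs ∷ʳ (m + j))))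
    ≡⟨ iterate-raise q m j _ (labeling-positive (next s) (gs ∷ʳ (m + j))) ⟩
  raise j (labeling (next s) (gs ∷ʳ (m + j)))
    ≡⟨ raise-arrange j (next s) (levels (gs ∷ʳ (m + j))) ⟩
  arrange (next s) (Vec.map (j +_) (levels (gs ∷ʳ (m + j))))
    ≡⟨ cong (arrange (next s)) (raise-levels-from j 1 (gs ∷ʳ (m + j))) ⟩
  arrange (next s) (levels-from (j + 1) (gs ∷ʳ (m + j)))
    ≡⟨ cong (λ v → arrange (next s) (levels-from v (gs ∷ʳ (m + j)))) (+-comm j 1) ⟩
  arrange (next s) (levels-from (suc j) (gs ∷ʳ (m + j)))          ∎
  where open ≡-Reasoning

record Reachable (q : ℕ) (f : Labeling) : Set where
  field
    {k}     : ℕ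
    shape   : Shape (suc (suc k))
    gaps    : Vec ℕ (suc (suc k))
    q≡      : q ≡ suc (suc k) + Vec.sum gaps
    steps   : ℕ
    reaches : iterate steps (Pro q) (labeling shape gaps) ≡ f

reachable⇒dichotomy : ∀ {q f} → Reachable q f → OrbitDichotomy q f
reachable⇒dichotomy {q} r = subst (OrbitDichotomy q) reaches (dichotomy-iterate (labeling-dichotomy shape gaps q≡) steps)
  where open Reachable r

reach₄ : ∀ {q} (s : Shape 4) {w x y z} → 1 ≤ w → w < x → x < y → y < z → z ≤ q →
         Reachable q (arrange (next s) (w ∷ x ∷ y ∷ z ∷ []))
reach₄ s {suc j} _ w<x x<y y<z z≤q
  with m≤n⇒∃[o]m+o≡n w<x | m≤n⇒∃[o]m+o≡n x<y | m≤n⇒∃[o]m+o≡n y<z | m≤n⇒∃[o]m+o≡n z≤q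
... | g₁ , refl | g₂ , refl | g₃ , refl | m , refl =
  record { shape = s ; gaps = m + j ∷ g₁ ∷ g₂ ∷ g₃ ∷ [] ; q≡ = q≡ ; steps = suc m
         ; reaches = reach-from-previous s j m (g₁ ∷ g₂ ∷ g₃ ∷ []) q≡ }
  where
  q≡ : suc (suc (suc (suc j) + g₁) + g₂) + g₃ + m ≡ 4 + Vec.sum (m + j ∷ g₁ ∷ g₂ ∷ g₃ ∷ [])
  q≡ = total j g₁ g₂ g₃ m
    where
    total : ∀ j g₁ g₂ g₃ m → suc (suc (suc (suc j) + g₁) + g₂) + g₃ + m ≡ 4 + (m + j + (g₁ + (g₂ + (g₃ + 0))))
    total = solve-∀

reach₃ : ∀ {q} (s : Shape 3) {w x y} → 1 ≤ w → w < x → x < y → y ≤ q →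
         Reachable q (arrange (next s) (w ∷ x ∷ y ∷ []))
reach₃ s {suc j} _ w<x x<y y≤q with m≤n⇒∃[o]m+o≡n w<x | m≤n⇒∃[o]m+o≡n x<y | m≤n⇒∃[o]m+o≡n y≤q
... | g₁ , refl | g₂ , refl | m , refl =
  record { shape = s ; gaps = m + j ∷ g₁ ∷ g₂ ∷ [] ; q≡ = q≡ ; steps = suc m
         ; reaches = reach-from-previous s j m (g₁ ∷ g₂ ∷ []) q≡ }
  where
  q≡ : suc (suc (suc j) + g₁) + g₂ + m ≡ 3 + Vec.sum (m + j ∷ g₁ ∷ g₂ ∷ [])
  q≡ = total j g₁ g₂ m
    where
    total : ∀ j g₁ g₂ m → suc (suc (suc j) + g₁) + g₂ + m ≡ 3 + (m + j + (g₁ + (g₂ + 0)))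
    total = solve-∀

reach₂ : ∀ {q} (s : Shape 2) {w x} → 1 ≤ w → w < x → x ≤ q → Reachable q (arrange (next s) (w ∷ x ∷ []))
reach₂ s {suc j} _ w<x x≤q with m≤n⇒∃[o]m+o≡n w<x | m≤n⇒∃[o]m+o≡n x≤q
... | g₁ , refl | m , refl =
  record { shape = s ; gaps = m + j ∷ g₁ ∷ [] ; q≡ = q≡ ; steps = suc m
         ; reaches = reach-from-previous s j m (g₁ ∷ []) q≡ }
  where
  q≡ : suc (suc j) + g₁ + m ≡ 2 + Vec.sum (m + j ∷ g₁ ∷ [])
  q≡ = total j g₁ m
    where
    total : ∀ j g₁ m → suc (suc j) + g₁ + m ≡ 2 + (m + j + (g₁ + 0))
    total = solve-∀

reachable : ∀ {q} f → Increasing q f → Reachable q f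
reachable (a ∷ b ∷ c ∷ d ∷ []) (1≤a , a<b , 1≤c , c<b , c<d , b≤q , d≤q) with <-cmp a c | <-cmp b d | <-cmp a d
... | tri< a<c _ _  | tri< b<d _ _  | _             = reach₄ s2413 1≤a a<c c<b b<d d≤q
... | tri< a<c _ _  | tri≈ _ refl _ | _             = reach₃ s2313 1≤a a<c c<b b≤q
... | tri< a<c _ _  | tri> _ _ d<b  | _             = reach₄ s2314 1≤a a<c c<d d<b b≤q
... | tri≈ _ refl _ | tri< b<d _ _  | _             = reach₃ s2312 1≤a a<b b<d d≤q
... | tri≈ _ refl _ | tri≈ _ refl _ | _             = reach₂ s1212 1≤a a<b b≤q
... | tri≈ _ refl _ | tri> _ _ d<b  | _             = reach₃ s1213 1≤a c<d d<b b≤q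
... | tri> _ _ c<a  | tri< b<d _ _  | tri< a<d _ _  = reach₄ s3412 1≤c c<a a<b b<d d≤q
... | tri> _ _ c<a  | tri≈ _ refl _ | _             = reach₃ s1312 1≤c c<a a<b b≤q
... | tri> _ _ c<a  | tri> _ _ d<b  | tri< a<d _ _  = reach₄ s1324 1≤c c<a a<d d<b b≤q
... | tri> _ _ c<a  | _             | tri≈ _ refl _ = reach₃ s1323 1≤c c<a a<b b≤q
... | tri> _ _ c<a  | _             | tri> _ _ d<a  = reach₄ s1423 1≤c c<d d<a a<b b≤q

-- The mean over Inc^q(Z₄), and the theorem

dual : ℕ → Labeling → Labeling
dual q f = tabulate (λ x → suc q ∸ lookup f (κ x))

dual-Increasing : ∀ {q} f → Increasing q f → Increasing q (dual q f)
dual-Increasing {q} (a ∷ b ∷ c ∷ d ∷ []) (1≤a , a<b , 1≤c , c<b , c<d , b≤q , d≤q) =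
  1≤suc-q∸ d≤q , ∸-monoʳ-< c<d (m≤n⇒m≤1+n d≤q) , 1≤suc-q∸ b≤q , ∸-monoʳ-< c<b (m≤n⇒m≤1+n b≤q) ,
  ∸-monoʳ-< a<b (m≤n⇒m≤1+n b≤q) , ∸-monoʳ-≤ (suc q) 1≤c , ∸-monoʳ-≤ (suc q) 1≤a
  where
  1≤suc-q∸ : ∀ {x} → x ≤ q → 1 ≤ suc q ∸ x
  1≤suc-q∸ x≤q = subst (1 ≤_) (sym (+-∸-assoc 1 x≤q)) (s≤s z≤n)

dual-involutive : ∀ {q} f → Increasing q f → dual q (dual q f) ≡ f
dual-involutive {q} (a ∷ b ∷ c ∷ d ∷ []) (1≤a , a<b , 1≤c , c<b , c<d , b≤q , d≤q) =
  cong₂ _∷_ (m∸[m∸n]≡n (≤-trans (<⇒≤ a<b) b≤q′)) (cong₂ _∷_ (m∸[m∸n]≡n b≤q′)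
    (cong₂ _∷_ (m∸[m∸n]≡n (≤-trans (<⇒≤ c<b) b≤q′)) (cong₂ _∷_ (m∸[m∸n]≡n (m≤n⇒m≤1+n d≤q)) refl)))
  where
  b≤q′ : b ≤ suc q
  b≤q′ = m≤n⇒m≤1+n b≤q

antipodalSum-dual : ∀ {q} x f → Increasing q f → antipodalSum x f + antipodalSum x (dual q f) ≡ suc q + suc q
antipodalSum-dual {q} x (a ∷ b ∷ c ∷ d ∷ []) (1≤a , a<b , 1≤c , c<b , c<d , b≤q , d≤q) = by-position x
  where
  pair : ∀ {u v} → u ≤ suc q → v ≤ suc q → (u + v) + ((suc q ∸ v) + (suc q ∸ u)) ≡ suc q + suc q
  pair {u} {v} u≤ v≤ = begin
    (u + v) + ((suc q ∸ v) + (suc q ∸ u)) ≡⟨ cong ((u + v) +_) (+-comm (suc q ∸ v) _) ⟩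
    (u + v) + ((suc q ∸ u) + (suc q ∸ v)) ≡⟨ interchange u v _ _ ⟩
    (u + (suc q ∸ u)) + (v + (suc q ∸ v)) ≡⟨ cong₂ _+_ (m+[n∸m]≡n u≤) (m+[n∸m]≡n v≤) ⟩
    suc q + suc q                         ∎
    where open ≡-Reasoning
  a≤ : a ≤ suc q
  a≤ = ≤-trans (<⇒≤ a<b) (m≤n⇒m≤1+n b≤q)
  b≤ : b ≤ suc q
  b≤ = m≤n⇒m≤1+n b≤q
  c≤ : c ≤ suc q
  c≤ = ≤-trans (<⇒≤ c<b) (m≤n⇒m≤1+n b≤q)
  d≤ : d ≤ suc q
  d≤ = m≤n⇒m≤1+n d≤q
  by-position : ∀ x → let f = a ∷ b ∷ c ∷ d ∷ [] in antipodalSum x f + antipodalSum x (dual q f) ≡ suc q + suc q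
  by-position x₁ = pair a≤ d≤
  by-position x₂ = pair b≤ c≤
  by-position x₃ = pair c≤ b≤
  by-position x₄ = pair d≤ a≤

antipodalSum-mean : ∀ q x → sum (map (antipodalSum x) (Inc q)) ≡ suc q * length (Inc q)
antipodalSum-mean q x = *-cancelˡ-≡ _ _ 2 (begin
  2 * S                           ≡⟨ cong (S +_) (+-identityʳ S) ⟩
  S + S                           ≡⟨ sum-involution (antipodalSum x) (dual q) (suc q + suc q) (Inc-unique q)
                                       (λ {f} f∈ → from (dual-Increasing f (to f∈)))
                                       (λ {f} f∈ → dual-involutive f (to f∈))
                                       (λ {f} f∈ → antipodalSum-dual x f (to f∈)) ⟩
  (suc q + suc q) * length (Inc q) ≡⟨ cong (_* length (Inc q)) (cong (suc q +_) (sym (+-identityʳ (suc q)))) ⟩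
  2 * (suc q) * length (Inc q)    ≡⟨ *-assoc 2 (suc q) _ ⟩
  2 * (suc q * length (Inc q))    ∎)
  where
  open ≡-Reasoning
  S : ℕ
  S = sum (map (antipodalSum x) (Inc q))
  to : ∀ {f} → f ∈ Inc q → Increasing q f
  to {f} = Equivalence.to (∈Inc⇔Increasing f)
  from : ∀ {f} → Increasing q f → f ∈ Inc q
  from {f} = Equivalence.from (∈Inc⇔Increasing f)

*-cancelʳ-≡⇔ : ∀ {a b} n .{{_ : NonZero n}} → (a * n ≡ b * n) ⇔ (a ≡ b)
*-cancelʳ-≡⇔ {a} {b} n = mk⇔ (*-cancelʳ-≡ a b n) (cong (_* n))

proportional-means : ∀ {a b c m n} .{{_ : NonZero m}} .{{_ : NonZero n}} → a * m ≡ b * n → (a ≡ c * n) ⇔ (b ≡ c * m)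
proportional-means {a} {b} {c} {m} {n} am≡bn = mk⇔
  (λ a≡cn → *-cancelʳ-≡ b (c * m) n (trans (sym am≡bn) (trans (cong (_* m) a≡cn) (swap c n m))))
  (λ b≡cm → *-cancelʳ-≡ a (c * n) m (trans am≡bn (trans (cong (_* n) b≡cm) (swap c m n))))
  where
  swap : ∀ c x y → c * x * y ≡ c * y * x
  swap c x y = trans (*-assoc c x y) (trans (cong (c *_) (*-comm x y)) (sym (*-assoc c y x)))

nonZero-length : ∀ {x : Labeling} {xs} → x ∈ xs → NonZero (length xs)
nonZero-length {xs = _ ∷ _} _ = _

module _ {q f} (f∈ : f ∈ Inc q) {p} (0<p : 0 < p) (periodic : iterate p (Pro q) f ≡ f) where

  private
    Pro-closed : ∀ {g} → g ∈ Inc q → Pro q g ∈ Inc q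
    Pro-closed {g} g∈ =
      Equivalence.from (∈Inc⇔Increasing (Pro q g)) (Pro-Increasing q g (Equivalence.to (∈Inc⇔Increasing g) g∈))

    instance
      Inc-nonZero : NonZero (length (Inc q))
      Inc-nonZero = nonZero-length f∈
      orbit-nonZero : NonZero (length (orbit q f))
      orbit-nonZero = nonZero-length (∈-orbitIn⁺ (Vec.≡-dec _≟_) (Pro q) (Inc q) (Inc-unique q) Pro-closed f∈ z≤n)
      period-nonZero : NonZero p
      period-nonZero = >-nonZero 0<p

  orbitmesic⇔ : ∀ x → Orbitmesic q (antipodalSum x) (orbit q f) ⇔ HasMean (suc q) (antipodalSum x) (iterates (Pro q) p f)
  orbitmesic⇔ x = begin
    ΣO * N ≡ sum (map (antipodalSum x) (Inc q)) * length O
      ≡⟨ cong (λ t → ΣO * N ≡ t * length O) (antipodalSum-mean q x) ⟩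
    ΣO * N ≡ suc q * N * length O                       ≡⟨ cong (ΣO * N ≡_) (swap (suc q) N (length O)) ⟩
    ΣO * N ≡ suc q * length O * N                       ≈⟨ *-cancelʳ-≡⇔ N ⟩
    ΣO ≡ suc q * length O                               ≈⟨ proportional-means {c = suc q} orbit-average′ ⟩
    Σp ≡ suc q * p
      ≡⟨ cong (λ n → Σp ≡ suc q * n) (length-iterates (Pro q) p f) ⟨
    HasMean (suc q) (antipodalSum x) (iterates (Pro q) p f) ∎
    where
    open ⇔-Reasoning
    O : List Labeling
    O = orbit q f
    N ΣO Σp : ℕ
    N = length (Inc q)
    ΣO = sum (map (antipodalSum x) O)
    Σp = sum (map (antipodalSum x) (iterates (Pro q) p f))
    orbit-average′ : ΣO * p ≡ Σp * length O
    orbit-average′ = orbit-average (Vec.≡-dec _≟_) (Pro q) (Inc q) (Inc-unique q) Pro-closed f∈ (antipodalSum x) 0<p periodic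
    swap : ∀ c x y → c * x * y ≡ c * y * x
    swap c x y = trans (*-assoc c x y) (trans (cong (c *_) (*-comm x y)) (sym (*-assoc c y x)))

  orbit-All⇔ : ∀ (P : Labeling → Set) → All P (orbit q f) ⇔ All P (iterates (Pro q) p f)
  orbit-All⇔ P = orbit-All (Vec.≡-dec _≟_) (Pro q) (Inc q) (Inc-unique q) Pro-closed f∈ P 0<p periodic

dichotomy⇒⇔ : ∀ {M A B M′ A′ B′ : Set} → M ⇔ M′ → A ⇔ A′ → B ⇔ B′ →
              (M′ × A′) ⊎ ((M′ ⇔ B′) × ¬ A′) → M ⇔ (A ⊎ B)
dichotomy⇒⇔ M⇔ A⇔ B⇔ (inj₁ (m , a)) = mk⇔ (λ _ → inj₁ (Equivalence.from A⇔ a)) (λ _ → Equivalence.from M⇔ m)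
dichotomy⇒⇔ M⇔ A⇔ B⇔ (inj₂ (m⇔b , ¬a)) = mk⇔
  (λ m → inj₂ (Equivalence.from B⇔ (Equivalence.to m⇔b (Equivalence.to M⇔ m))))
  λ { (inj₁ a) → contradiction (Equivalence.to A⇔ a) ¬a
    ; (inj₂ b) → Equivalence.from M⇔ (Equivalence.from m⇔b (Equivalence.to B⇔ b)) }

theorem7p8 : (q : ℕ) (f : Labeling) → f ∈ Inc q → (x : Z4) →
    Orbitmesic q (antipodalSum x) (orbit q f)
    ⇔ (OrbitAvoids (1 ∷ 3 ∷ 2 ∷ 4 ∷ []) (orbit q f) ⊎ OrbitBalanced q (orbit q f))
theorem7p8 q f f∈ x =
  dichotomy⇒⇔ (orbitmesic⇔ f∈ 0<period periodic x) (orbit-All⇔ f∈ 0<period periodic (Avoids π1324))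
            (orbit-All⇔ f∈ 0<period periodic (Balanced q)) (at-x dichotomy)
  where
  open OrbitDichotomy (reachable⇒dichotomy (reachable f (Equivalence.to (∈Inc⇔Increasing {q} f) f∈)))
  at-x : Dichotomy q (iterates (Pro q) period f) → _
  at-x (inj₁ (means , avoids))   = inj₁ (means x , avoids)
  at-x (inj₂ (means⇔ , ¬avoids)) = inj₂ (means⇔ x , ¬avoids)
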